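{- Let $n\ge 3$ and let $a=(a_1,\dots,a_n)$ be an area sequence. Let $\ell$ be an integer with $2\le \ell\le n-1$ and let $i\in[n]$ satisfy $a_{i-1}+\ell-1\le a_i$, where by convention $a_0=1$. For $z=0,1,\dots,\ell$ let $a^{z}$ be the sequence with $a^{z}_j=a_j$ for $j\neq i$ and $a^{z}_i=a_i-z$, and assume these $a^z$ are area sequences; let $G_z$ be the graph with area sequence $a^z$ (so $G_0$ is the graph of $a$). Suppose moreover that $$a_{i+a_i-1}=a_{i+a_i}+1,\quad a_{i+a_i-2}=a_{i+a_i-1}+1,\quad \dots,\quad a_{i+a_i-\ell+1}=a_{i+a_i-\ell+2}+1 .$$ Then for every $1\le k\le \ell-1$: (a) $\mathrm{LLT}_{G_0}(\mathbf{x};q)+q[k]_q\,\mathrm{LLT}_{G_{k+1}}(\mathbf{x};q)=[k+1]_q\,\mathrm{LLT}_{G_k}(\mathbf{x};q)$; (b) $[\ell-k]_q\,\mathrm{LLT}_{G_0}(\mathbf{x};q)+q^{\ell-k}[k]_q\,\mathrm{LLT}_{G_\ell}(\mathbf{x};q)=[\ell]_q\,\mathrm{LLT}_{G_k}(\mathbf{x};q)$; and equivalently the same two identities hold with $\mathrm{LLT}_{G_z}$ replaced by $X_{G_z}$ throughout: (a$'$) $X_{G_0}(\mathbf{x};q)+q[k]_qX_{G_{k+1}}(\mathbf{x};q)=[k+1]_qX_{G_k}(\mathbf{x};q)$; (b$'$) $[\ell-k]_qX_{G_0}(\mathbf{x};q)+q^{\ell-k}[k]_qX_{G_\ell}(\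mathbf{x};q)=[\ell]_qX_{G_k}(\mathbf{x};q)$.
   Context: For a positive integer $n$, $[n]=\{1,\dots,n\}$, $[n]_q=1+q+\dots+q^{n-1}$ ($[0]_q=0$). An area sequence of length $n$ is a sequence $(a_1,\dots,a_n)$ of nonnegative integers with $a_n=0$, $a_j\le n-j$ and $a_{j+1}\ge a_j-1$ for all $j$; it determines the graph on vertex set $[n]$ with edge set $\{\{j,k\}: j<k\le j+a_j\}$ (these are exactly the incomparability graphs of natural unit interval orders on $[n]$, and $a_j$ is the number of neighbours $k>j$ of $j$). For a graph $G$ on $[n]$ and a map $\kappa:[n]\to\mathbb{Z}_{>0}$, let $\mathrm{asc}(\kappa)$ be the number of edges $\{j,k\}$ with $j<k$ and $\kappa(j)<\kappa(k)$, and $x^\kappa=\prod_{v}x_{\kappa(v)}$. The chromatic quasisymmetric function is $X_G(\mathbf{x};q)=\sum_{\kappa}q^{\mathrm{asc}(\kappa)}x^\kappa$ over proper colorings $\kappa$ (adjacent vertices get distinct colors), and the unicellular LLT polynomial is $\mathrm{LLT}_G(\mathbf{x};q)=\sum_{\kappa}q^{\mathrm{asc}(\kappa)}x^\kappa$ over all maps $\kappa:[n]\to\mathbb{Z}_{>0}$. -}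

module Defs where

open import Data.Nat using (ℕ; zero; suc; _+_; _∸_; _≤_; _<_; _≤?_; _<?_)
open import Data.Nat.Properties using (_≟_)
open import Data.Fin using (Fin; toℕ)
import Data.Fin.Properties as FinP
open import Data.Vec using (Vec; []; _∷_; lookup; tabulate; count)
import Data.Vec.Properties as VecP
open import Data.List using (List; [_]; map; concatMap; length; filter; cartesianProduct; allFin)
open import Data.List.Relation.Unary.All using (All; all?)
open import Data.Product using (_×_; _,_)
open import Data.Bool using (if_then_else_)
open import Relation.Nullary using (¬_; Dec; does)
open import Relation.Nullary.Decidable using (_×-dec_; _→-dec_; ¬?)
open import Relation.Binary.PropositionalEquality using (_≡_)

-- Sequences a = (a_1,…,a_n) are modelled as functions ℕ → ℕ;
-- only the values at 1,…,n matter (a j is a_j).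

IsAreaSeq : ℕ → (ℕ → ℕ) → Set
IsAreaSeq n a =
  (a n ≡ 0) ×
  ((j : ℕ) → 1 ≤ j → j ≤ n → a j ≤ n ∸ j) ×
  ((j : ℕ) → 1 ≤ j → j < n → a j ∸ 1 ≤ a (suc j))
  -- a_{j+1} ≥ a_j - 1 (in ℕ; equivalent since a_{j+1} ≥ 0)

ext0 : (ℕ → ℕ) → ℕ → ℕ
ext0 a zero    = 1
ext0 a (suc j) = a (suc j)

modify : (ℕ → ℕ) → ℕ → ℕ → (ℕ → ℕ)
modify a i z j = if does (j ≟ i) then a i ∸ z else a j

-- The graph of an area sequence on vertex set Fin n; vertex v stands for
-- the integer toℕ v + 1 ∈ [n].  Edge {j,k} with j<k iff k ≤ j + a_j.

EdgeLt : (ℕ → ℕ) → {n : ℕ} → Fin n → Fin n → Set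
EdgeLt a j k = (toℕ j < toℕ k) × (toℕ k ≤ toℕ j + a (suc (toℕ j)))

edgeLt? : (a : ℕ → ℕ) → {n : ℕ} → (j k : Fin n) → Dec (EdgeLt a j k)
edgeLt? a j k = (toℕ j <? toℕ k) ×-dec (toℕ k ≤? toℕ j + a (suc (toℕ j)))

pairs : (n : ℕ) → List (Fin n × Fin n)
pairs n = cartesianProduct (allFin n) (allFin n)

allMaps : (n m : ℕ) → List (Vec (Fin m) n)
allMaps zero    m = [ [] ]
allMaps (suc n) m = concatMap (λ c → map (c ∷_) (allMaps n m)) (allFin m)

asc : (ℕ → ℕ) → {n m : ℕ} → Vec (Fin m) n → ℕ
asc a {n} κ = length (filter
  (λ p → edgeLt? a (Data.Product.proj₁ p) (Data.Product.proj₂ p)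
         ×-dec (toℕ (lookup κ (Data.Product.proj₁ p)) <? toℕ (lookup κ (Data.Product.proj₂ p))))
  (pairs n))

Proper : (ℕ → ℕ) → {n m : ℕ} → Vec (Fin m) n → Set
Proper a {n} κ = All (λ p → EdgeLt a (Data.Product.proj₁ p) (Data.Product.proj₂ p) →
                        ¬ (lookup κ (Data.Product.proj₁ p) ≡ lookup κ (Data.Product.proj₂ p)))
                     (pairs n)

proper? : (a : ℕ → ℕ) → {n m : ℕ} → (κ : Vec (Fin m) n) → Dec (Proper a κ)
proper? a {n} κ = all? (λ p → edgeLt? a (Data.Product.proj₁ p) (Data.Product.proj₂ p) →-dec
                         ¬? (lookup κ (Data.Product.proj₁ p) FinP.≟ lookup κ (Data.Product.proj₂ p)))
                       (pairs n)

-- content of κ: multiplicity of each color, i.e. the exponent vector of x^κ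
content : {n m : ℕ} → Vec (Fin m) n → Vec ℕ m
content κ = tabulate (λ c → count (λ d → d FinP.≟ c) κ)

-- Polynomials in q with natural coefficients, as coefficient functions.

Poly : Set
Poly = ℕ → ℕ

_≐_ : Poly → Poly → Set
P ≐ Q = (d : ℕ) → P d ≡ Q d

_⊕_ : Poly → Poly → Poly
(P ⊕ Q) d = P d + Q d

qpow : ℕ → Poly → Poly
qpow zero    P d       = P d
qpow (suc j) P zero    = 0
qpow (suc j) P (suc d) = qpow j P d

-- multiplication by [k]_q = 1 + q + … + q^{k-1}  ([0]_q = 0)
qint : ℕ → Poly → Poly
qint zero    P d = 0
qint (suc k) P d = P d + qpow 1 (qint k P) d

-- Coefficient of x^α (α : Vec ℕ m, a monomial in x_1,…,x_m) in
-- LLT_G(x;q) and X_G(x;q), as a polynomial in q: coefficient of q^d is the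
-- number of maps (resp. proper colorings) κ : [n] → [m] with x^κ = x^α and
-- asc(κ) = d.  Every monomial in x_1,x_2,… lies in some x_1,…,x_m.

LLTcoef : (n : ℕ) → (ℕ → ℕ) → (m : ℕ) → Vec ℕ m → Poly
LLTcoef n a m α d = length (filter
  (λ κ → VecP.≡-dec _≟_ (content κ) α ×-dec (asc a κ ≟ d))
  (allMaps n m))

Xcoef : (n : ℕ) → (ℕ → ℕ) → (m : ℕ) → Vec ℕ m → Poly
Xcoef n a m α d = length (filter
  (λ κ → proper? a κ ×-dec VecP.≡-dec _≟_ (content κ) α ×-dec (asc a κ ≟ d))
  (allMaps n m))

module Submission where

-- For s + 2 ≤ ℓ the graphs G_s ⊇ G_{s+1} ⊇ G_{s+2} differ by the
--     edges {i, v} and {i, u}, where u = i + a_i - s - 1 and v = u + 1, and the hypotheses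
--     on a make u and v twins in G_{s+2}: adjacent, with the same neighbours otherwise.
--     Exchanging the colours of u and v is an involution on colourings, and on each orbit
--     the contributions to G_s + q G_{s+2} and to [2]_q G_{s+1} agree, by a case analysis
--     on the relative order of the colours of i, u and v.  Hence
--     G_s + q G_{s+2} = [2]_q G_{s+1}, for LLT and for X, coefficient by coefficient.
-- (2) Algebra.  Any polynomials G_0, ..., G_ℓ with natural coefficients satisfying these
--     modular relations satisfy (a) and (b) (relationA, relationB), by inductions that use
--     only cancellation of addition.

open import Defs
open import Level using (0ℓ)
open import Data.Nat using (ℕ; zero; suc; _+_; _*_; _∸_; _≤_; _<_; _<?_; _≤?_; s≤s; z≤n; s≤s⁻¹)
open import Data.Nat.Properties
open import Data.Bool using (Bool; true; false; _∧_)
open import Data.Fin as Fin using (Fin; toℕ; fromℕ<)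
import Data.Fin.Properties as FinP
open import Data.List as List using (List; []; _∷_; concatMap; length; filter; _++_; cartesianProduct; allFin)
open import Data.List.Relation.Unary.All using (all?)
open import Data.Vec using (Vec; []; _∷_; lookup; tabulate; count)
import Data.Vec.Properties as VecP
open import Data.Product using (_×_; _,_; proj₁; proj₂; uncurry)
open import Data.Product.Properties using (,-injective)
open import Data.Sum using (_⊎_; inj₁; inj₂)
open import Data.Empty using (⊥-elim)
open import Function using (_∘_)
open import Relation.Nullary using (¬_; Dec; does; yes; no)
open import Relation.Nullary.Decidable using (_×-dec_; _→-dec_; ¬?; map′; dec-true; dec-false)
open import Relation.Binary.Definitions using (DecidableEquality; tri<; tri≈; tri>)
open import Relation.Binary.PropositionalEquality
import Algebra.Construct.Pointwise as Pointwise
open import Algebra.Bundles using (CommutativeMonoid)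
open import Algebra.Properties.CommutativeSemigroup +-commutativeSemigroup
  using () renaming (interchange to +-interchange)

bit : Bool → ℕ
bit true  = 1
bit false = 0

𝟙 : ∀ {p} {P : Set p} → Dec P → ℕ
𝟙 d = bit (does d)

bit-∧ : ∀ x y → bit (x ∧ y) ≡ bit x * bit y
bit-∧ true  y = sym (+-identityʳ (bit y))
bit-∧ false y = refl

𝟙-yes : ∀ {p} {P : Set p} → P → (d : Dec P) → 𝟙 d ≡ 1
𝟙-yes p (yes _) = refl
𝟙-yes p (no ¬p) = ⊥-elim (¬p p)

𝟙-no : ∀ {p} {P : Set p} → ¬ P → (d : Dec P) → 𝟙 d ≡ 0
𝟙-no ¬p (yes p) = ⊥-elim (¬p p)
𝟙-no ¬p (no _)  = refl

𝟙-⇔ : ∀ {p q} {P : Set p} {Q : Set q} → (P → Q) → (Q → P) → (d : Dec P) (e : Dec Q) → 𝟙 d ≡ 𝟙 e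
𝟙-⇔ f g (yes p) e = sym (𝟙-yes (f p) e)
𝟙-⇔ f g (no ¬p) e = sym (𝟙-no (λ q → ¬p (g q)) e)

𝟙≤1 : ∀ {p} {P : Set p} (d : Dec P) → 𝟙 d ≤ 1
𝟙≤1 (yes _) = s≤s z≤n
𝟙≤1 (no _)  = z≤n

𝟙≡-* : ∀ {a} {A : Set a} (_≟_ : DecidableEquality A) x y (g : A → ℕ) →
       𝟙 (x ≟ y) * g x ≡ 𝟙 (x ≟ y) * g y
𝟙≡-* _≟_ x y g with x ≟ y
... | yes refl = refl
... | no  _    = refl

∑ : ∀ {a} {A : Set a} → List A → (A → ℕ) → ℕ
∑ []       f = 0
∑ (x ∷ xs) f = f x + ∑ xs f

module _ {a} {A : Set a} where

  ∑-cong : (xs : List A) {f g : A → ℕ} → (∀ x → f x ≡ g x) → ∑ xs f ≡ ∑ xs g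
  ∑-cong []       e = refl
  ∑-cong (x ∷ xs) e = cong₂ _+_ (e x) (∑-cong xs e)

  ∑-+ : (xs : List A) (f g : A → ℕ) → ∑ xs (λ x → f x + g x) ≡ ∑ xs f + ∑ xs g
  ∑-+ []       f g = refl
  ∑-+ (x ∷ xs) f g = trans (cong (f x + g x +_) (∑-+ xs f g)) (+-interchange (f x) (g x) _ _)

  ∑-zero : (xs : List A) → ∑ xs (λ _ → 0) ≡ 0
  ∑-zero []       = refl
  ∑-zero (x ∷ xs) = ∑-zero xs

  ∑-*ˡ : (xs : List A) (c : ℕ) (f : A → ℕ) → ∑ xs (λ x → c * f x) ≡ c * ∑ xs f
  ∑-*ˡ []       c f = sym (*-zeroʳ c)
  ∑-*ˡ (x ∷ xs) c f = trans (cong (c * f x +_) (∑-*ˡ xs c f)) (sym (*-distribˡ-+ c (f x) _))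

  ∑-++ : (xs ys : List A) (f : A → ℕ) → ∑ (xs ++ ys) f ≡ ∑ xs f + ∑ ys f
  ∑-++ []       ys f = refl
  ∑-++ (x ∷ xs) ys f = trans (cong (f x +_) (∑-++ xs ys f)) (sym (+-assoc (f x) _ _))

  ∑-mono : (xs : List A) {f g : A → ℕ} → (∀ x → f x ≤ g x) → ∑ xs f ≤ ∑ xs g
  ∑-mono []       e = z≤n
  ∑-mono (x ∷ xs) e = +-mono-≤ (e x) (∑-mono xs e)

  length-filter : ∀ {p} {P : A → Set p} (P? : ∀ x → Dec (P x)) (xs : List A) →
                  length (filter P? xs) ≡ ∑ xs (λ x → 𝟙 (P? x))
  length-filter P? []       = refl
  length-filter P? (x ∷ xs) with does (P? x)
  ... | true  = cong suc (length-filter P? xs)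
  ... | false = length-filter P? xs

module _ {a b} {A : Set a} {B : Set b} where

  ∑-map : (g : A → B) (xs : List A) (f : B → ℕ) → ∑ (List.map g xs) f ≡ ∑ xs (f ∘ g)
  ∑-map g []       f = refl
  ∑-map g (x ∷ xs) f = cong (f (g x) +_) (∑-map g xs f)

  ∑-concatMap : (h : A → List B) (xs : List A) (f : B → ℕ) →
                ∑ (concatMap h xs) f ≡ ∑ xs (λ x → ∑ (h x) f)
  ∑-concatMap h []       f = refl
  ∑-concatMap h (x ∷ xs) f =
    trans (∑-++ (h x) (concatMap h xs) f) (cong (∑ (h x) f +_) (∑-concatMap h xs f))

  ∑-comm : (xs : List A) (ys : List B) (f : A → B → ℕ) →
           ∑ xs (λ x → ∑ ys (f x)) ≡ ∑ ys (λ y → ∑ xs (λ x → f x y))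
  ∑-comm []       ys f = sym (∑-zero ys)
  ∑-comm (x ∷ xs) ys f =
    trans (cong (∑ ys (f x) +_) (∑-comm xs ys f)) (sym (∑-+ ys (f x) _))

∑-cartesianProduct : ∀ {a b} {A : Set a} {B : Set b} (xs : List A) (ys : List B) (f : A × B → ℕ) →
                     ∑ (cartesianProduct xs ys) f ≡ ∑ xs (λ x → ∑ ys (λ y → f (x , y)))
∑-cartesianProduct []       ys f = refl
∑-cartesianProduct (x ∷ xs) ys f =
  trans (∑-++ (List.map (x ,_) ys) (cartesianProduct xs ys) f)
        (cong₂ _+_ (∑-map (x ,_) ys f) (∑-cartesianProduct xs ys f))

∑-tabulate : ∀ {a} {A : Set a} n (h : Fin n → A) (f : A → ℕ) →
             ∑ (List.tabulate h) f ≡ ∑ (allFin n) (f ∘ h)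
∑-tabulate zero    h f = refl
∑-tabulate (suc n) h f =
  cong (f (h Fin.zero) +_) (trans (∑-tabulate n (h ∘ Fin.suc) f) (sym (∑-tabulate n Fin.suc (f ∘ h))))

double-injective : ∀ x y → x + x ≡ y + y → x ≡ y
double-injective x y e = *-cancelʳ-≡ x y 2 (trans (twice x) (trans e (sym (twice y))))
  where
  twice : ∀ z → z * 2 ≡ z + z
  twice z = trans (*-comm z 2) (cong (z +_) (+-identityʳ z))

record Once {a} {A : Set a} (_≟_ : DecidableEquality A) (L : List A) : Set a where
  constructor exactlyOnce
  field occurrences : ∀ x → ∑ L (λ y → 𝟙 (y ≟ x)) ≡ 1
open Once

module Enumeration {a} {A : Set a} (_≟_ : DecidableEquality A) (L : List A) (once : Once _≟_ L) where

  sift : ∀ x (g : A → ℕ) → ∑ L (λ y → 𝟙 (y ≟ x) * g y) ≡ g x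
  sift x g = begin
    ∑ L (λ y → 𝟙 (y ≟ x) * g y)   ≡⟨ ∑-cong L (λ y → 𝟙≡-* _≟_ y x g) ⟩
    ∑ L (λ y → 𝟙 (y ≟ x) * g x)   ≡⟨ ∑-cong L (λ y → *-comm (𝟙 (y ≟ x)) (g x)) ⟩
    ∑ L (λ y → g x * 𝟙 (y ≟ x))   ≡⟨ ∑-*ˡ L (g x) _ ⟩
    g x * ∑ L (λ y → 𝟙 (y ≟ x))   ≡⟨ cong (g x *_) (occurrences once x) ⟩
    g x * 1                       ≡⟨ *-identityʳ (g x) ⟩
    g x                           ∎
    where open ≡-Reasoning

  extract : ∀ x (f g h : A → ℕ) → (∀ y → f y ≡ 𝟙 (y ≟ x) + g y) →
            ∑ L (λ y → f y * h y) ≡ h x + ∑ L (λ y → g y * h y)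
  extract x f g h f≡ = begin
    ∑ L (λ y → f y * h y)
      ≡⟨ ∑-cong L (λ y → trans (cong (_* h y) (f≡ y)) (*-distribʳ-+ (h y) (𝟙 (y ≟ x)) (g y))) ⟩
    ∑ L (λ y → 𝟙 (y ≟ x) * h y + g y * h y)           ≡⟨ ∑-+ L _ _ ⟩
    ∑ L (λ y → 𝟙 (y ≟ x) * h y) + ∑ L (λ y → g y * h y) ≡⟨ cong (_+ _) (sift x h) ⟩
    h x + ∑ L (λ y → g y * h y)                       ∎
    where open ≡-Reasoning

  reindex : (τ : A → A) → (∀ x → τ (τ x) ≡ x) → (g : A → ℕ) → ∑ L (g ∘ τ) ≡ ∑ L g
  reindex τ τ∘τ g = begin
    ∑ L (g ∘ τ)                                    ≡⟨ ∑-cong L (λ x → sift (τ x) g) ⟨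
    ∑ L (λ x → ∑ L (λ y → 𝟙 (y ≟ τ x) * g y))     ≡⟨ ∑-comm L L _ ⟩
    ∑ L (λ y → ∑ L (λ x → 𝟙 (y ≟ τ x) * g y))
      ≡⟨ ∑-cong L (λ y → ∑-cong L (λ x → cong (_* g y) (swapped y x))) ⟩
    ∑ L (λ y → ∑ L (λ x → 𝟙 (x ≟ τ y) * g y))     ≡⟨ ∑-cong L (λ y → sift (τ y) (λ _ → g y)) ⟩
    ∑ L g                                          ∎
    where
    open ≡-Reasoning
    swapped : ∀ y x → 𝟙 (y ≟ τ x) ≡ 𝟙 (x ≟ τ y)
    swapped y x = 𝟙-⇔ (λ e → trans (sym (τ∘τ x)) (cong τ (sym e)))
                      (λ e → trans (sym (τ∘τ y)) (cong τ (sym e))) (y ≟ τ x) (x ≟ τ y)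

  pairing : (τ : A → A) → (∀ x → τ (τ x) ≡ x) → (f g : A → ℕ) →
            (∀ x → f x + f (τ x) ≡ g x + g (τ x)) → ∑ L f ≡ ∑ L g
  pairing τ τ∘τ f g orbit = double-injective _ _ (begin
    ∑ L f + ∑ L f                  ≡⟨ cong (∑ L f +_) (reindex τ τ∘τ f) ⟨
    ∑ L f + ∑ L (f ∘ τ)            ≡⟨ ∑-+ L f (f ∘ τ) ⟨
    ∑ L (λ x → f x + f (τ x))      ≡⟨ ∑-cong L orbit ⟩
    ∑ L (λ x → g x + g (τ x))      ≡⟨ ∑-+ L g (g ∘ τ) ⟩
    ∑ L g + ∑ L (g ∘ τ)            ≡⟨ cong (∑ L g +_) (reindex τ τ∘τ g) ⟩
    ∑ L g + ∑ L g                  ∎)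
    where open ≡-Reasoning

once-∑∑ : ∀ {a b} {A : Set a} {B : Set b} {_≟ᴬ_ : DecidableEquality A} {_≟ᴮ_ : DecidableEquality B}
          {L : List A} {M : List B} → Once _≟ᴬ_ L → Once _≟ᴮ_ M →
          ∀ x y → ∑ L (λ a → ∑ M (λ b → 𝟙 (a ≟ᴬ x) * 𝟙 (b ≟ᴮ y))) ≡ 1
once-∑∑ {_≟ᴬ_ = _≟ᴬ_} {_≟ᴮ_} {L} {M} onceL onceM x y = begin
  ∑ L (λ a → ∑ M (λ b → 𝟙 (a ≟ᴬ x) * 𝟙 (b ≟ᴮ y)))   ≡⟨ ∑-cong L (λ a → ∑-*ˡ M (𝟙 (a ≟ᴬ x)) _) ⟩
  ∑ L (λ a → 𝟙 (a ≟ᴬ x) * ∑ M (λ b → 𝟙 (b ≟ᴮ y)))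
    ≡⟨ ∑-cong L (λ a → cong (𝟙 (a ≟ᴬ x) *_) (occurrences onceM y)) ⟩
  ∑ L (λ a → 𝟙 (a ≟ᴬ x) * 1)                         ≡⟨ ∑-cong L (λ a → *-identityʳ _) ⟩
  ∑ L (λ a → 𝟙 (a ≟ᴬ x))                             ≡⟨ occurrences onceL x ⟩
  1                                                  ∎
  where open ≡-Reasoning

once-allFin : ∀ n → Once FinP._≟_ (allFin n)
once-allFin n = exactlyOnce (occurrencesOf n)
  where
  occurrencesOf : ∀ n (x : Fin n) → ∑ (allFin n) (λ y → 𝟙 (y FinP.≟ x)) ≡ 1
  occurrencesOf (suc n) Fin.zero    = cong suc (trans (∑-tabulate n Fin.suc _) (∑-zero (allFin n)))
  occurrencesOf (suc n) (Fin.suc x) = trans (∑-tabulate n Fin.suc _) (occurrencesOf n x)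

polyMonoid : CommutativeMonoid 0ℓ 0ℓ
polyMonoid = Pointwise.commutativeMonoid ℕ +-0-commutativeMonoid

open CommutativeMonoid polyMonoid
  using () renaming (setoid to ≐-setoid; comm to ⊕-comm; assoc to ⊕-assoc; ∙-cong to ⊕-cong; sym to ≐-sym)
open import Algebra.Properties.CommutativeSemigroup (CommutativeMonoid.commutativeSemigroup polyMonoid)
  using (xy∙z≈xz∙y; xy∙z≈zy∙x) renaming (interchange to ⊕-interchange)

module _ where
  open import Relation.Binary.Reasoning.Setoid ≐-setoid

  0P : Poly
  0P _ = 0

  ⊕-cancelʳ : ∀ {P Q} R → (P ⊕ R) ≐ (Q ⊕ R) → P ≐ Q
  ⊕-cancelʳ R e d = +-cancelʳ-≡ (R d) _ _ (e d)

  ⊕-congˡ : ∀ P {Q Q'} → Q ≐ Q' → (P ⊕ Q) ≐ (P ⊕ Q')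
  ⊕-congˡ P e d = cong (P d +_) (e d)

  ⊕-congʳ : ∀ Q {P P'} → P ≐ P' → (P ⊕ Q) ≐ (P' ⊕ Q)
  ⊕-congʳ Q e d = cong (_+ Q d) (e d)

  qpow-cong : ∀ j {P Q} → P ≐ Q → qpow j P ≐ qpow j Q
  qpow-cong zero    e d       = e d
  qpow-cong (suc j) e zero    = refl
  qpow-cong (suc j) e (suc d) = qpow-cong j e d

  qpow-⊕ : ∀ j P Q → qpow j (P ⊕ Q) ≐ (qpow j P ⊕ qpow j Q)
  qpow-⊕ zero    P Q d       = refl
  qpow-⊕ (suc j) P Q zero    = refl
  qpow-⊕ (suc j) P Q (suc d) = qpow-⊕ j P Q d

  qpow-0P : ∀ j → qpow j 0P ≐ 0P
  qpow-0P zero    d       = refl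
  qpow-0P (suc j) zero    = refl
  qpow-0P (suc j) (suc d) = qpow-0P j d

  qpow-qpow : ∀ a b P → qpow a (qpow b P) ≐ qpow (a + b) P
  qpow-qpow zero    b P d       = refl
  qpow-qpow (suc a) b P zero    = refl
  qpow-qpow (suc a) b P (suc d) = qpow-qpow a b P d

  qpow-comm : ∀ a b P → qpow a (qpow b P) ≐ qpow b (qpow a P)
  qpow-comm a b P = begin
    qpow a (qpow b P) ≈⟨ qpow-qpow a b P ⟩
    qpow (a + b) P    ≈⟨ (λ d → cong (λ c → qpow c P d) (+-comm a b)) ⟩
    qpow (b + a) P    ≈⟨ qpow-qpow b a P ⟨
    qpow b (qpow a P) ∎

  qint-cong : ∀ k {P Q} → P ≐ Q → qint k P ≐ qint k Q
  qint-cong zero    e d = refl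
  qint-cong (suc k) e   = ⊕-cong e (qpow-cong 1 (qint-cong k e))

  qint-⊕ : ∀ k P Q → qint k (P ⊕ Q) ≐ (qint k P ⊕ qint k Q)
  qint-⊕ zero    P Q d = refl
  qint-⊕ (suc k) P Q   = begin
    (P ⊕ Q) ⊕ qpow 1 (qint k (P ⊕ Q))                ≈⟨ ⊕-congˡ (P ⊕ Q) (qpow-cong 1 (qint-⊕ k P Q)) ⟩
    (P ⊕ Q) ⊕ qpow 1 (qint k P ⊕ qint k Q)           ≈⟨ ⊕-congˡ (P ⊕ Q) (qpow-⊕ 1 (qint k P) (qint k Q)) ⟩
    (P ⊕ Q) ⊕ (qpow 1 (qint k P) ⊕ qpow 1 (qint k Q)) ≈⟨ ⊕-interchange P Q _ _ ⟩
    qint (suc k) P ⊕ qint (suc k) Q                   ∎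

  qint-0P : ∀ k → qint k 0P ≐ 0P
  qint-0P zero    d = refl
  qint-0P (suc k) d = trans (qpow-cong 1 (qint-0P k) d) (qpow-0P 1 d)

  qpow-qint : ∀ j k P → qpow j (qint k P) ≐ qint k (qpow j P)
  qpow-qint j zero    P = qpow-0P j
  qpow-qint j (suc k) P = begin
    qpow j (P ⊕ qpow 1 (qint k P))          ≈⟨ qpow-⊕ j P _ ⟩
    qpow j P ⊕ qpow j (qpow 1 (qint k P))   ≈⟨ ⊕-congˡ (qpow j P) (qpow-comm j 1 (qint k P)) ⟩
    qpow j P ⊕ qpow 1 (qpow j (qint k P))   ≈⟨ ⊕-congˡ (qpow j P) (qpow-cong 1 (qpow-qint j k P)) ⟩
    qpow j P ⊕ qpow 1 (qint k (qpow j P))   ∎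

  qint-sucʳ : ∀ k P → qint (suc k) P ≐ (qint k P ⊕ qpow k P)
  qint-sucʳ zero    P d = trans (cong (P d +_) (qpow-0P 1 d)) (+-identityʳ (P d))
  qint-sucʳ (suc k) P   = begin
    P ⊕ qpow 1 (qint (suc k) P)                        ≈⟨ ⊕-congˡ P (qpow-cong 1 (qint-sucʳ k P)) ⟩
    P ⊕ qpow 1 (qint k P ⊕ qpow k P)                   ≈⟨ ⊕-congˡ P (qpow-⊕ 1 (qint k P) (qpow k P)) ⟩
    P ⊕ (qpow 1 (qint k P) ⊕ qpow 1 (qpow k P))         ≈⟨ ⊕-assoc P _ _ ⟨
    qint (suc k) P ⊕ qpow 1 (qpow k P)                 ≈⟨ ⊕-congˡ (qint (suc k) P) (qpow-qpow 1 k P) ⟩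
    qint (suc k) P ⊕ qpow (suc k) P                    ∎

  qint-comm : ∀ a b P → qint a (qint b P) ≐ qint b (qint a P)
  qint-comm a zero    P = qint-0P a
  qint-comm a (suc b) P = begin
    qint a (P ⊕ qpow 1 (qint b P))          ≈⟨ qint-⊕ a P _ ⟩
    qint a P ⊕ qint a (qpow 1 (qint b P))   ≈⟨ ⊕-congˡ (qint a P) (qpow-qint 1 a (qint b P)) ⟨
    qint a P ⊕ qpow 1 (qint a (qint b P))   ≈⟨ ⊕-congˡ (qint a P) (qpow-cong 1 (qint-comm a b P)) ⟩
    qint a P ⊕ qpow 1 (qint b (qint a P))   ∎

  qint-2 : ∀ P → qint 2 P ≐ (P ⊕ qpow 1 P)
  qint-2 P = ⊕-congˡ P (qpow-cong 1 (qint-sucʳ 0 P))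

  ModularUpTo : (ℕ → Poly) → ℕ → Set
  ModularUpTo G ℓ = ∀ s → 2 + s ≤ ℓ → (G s ⊕ qpow 1 (G (2 + s))) ≐ qint 2 (G (suc s))

  -- The step multiplies the k-th modular relation by [k+1]_q, substitutes the
  -- induction hypothesis and cancels q[k]_q G_{k+1}.
  relationA : ∀ {G ℓ} → ModularUpTo G ℓ → ∀ k → k < ℓ →
              (G 0 ⊕ qpow 1 (qint k (G (suc k)))) ≐ qint (suc k) (G k)
  relationA {G} M zero    _         = ⊕-congˡ (G 0) (qpow-cong 1 (λ _ → refl))
  relationA {G} M (suc k) 2+k≤ℓ     = ⊕-cancelʳ (qpow 1 (qint k G₁)) (begin
      (G 0 ⊕ qpow 1 (qint (suc k) G₂)) ⊕ qpow 1 (qint k G₁)     ≈⟨ xy∙z≈xz∙y (G 0) _ _ ⟩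
      (G 0 ⊕ qpow 1 (qint k G₁)) ⊕ qpow 1 (qint (suc k) G₂)
        ≈⟨ ⊕-congʳ (qpow 1 (qint (suc k) G₂)) (relationA M k (<⇒≤ 2+k≤ℓ)) ⟩
      qint (suc k) (G k) ⊕ qpow 1 (qint (suc k) G₂)             ≈⟨ ⊕-congˡ (qint (suc k) (G k)) (qpow-qint 1 (suc k) G₂) ⟩
      qint (suc k) (G k) ⊕ qint (suc k) (qpow 1 G₂)             ≈⟨ qint-⊕ (suc k) (G k) _ ⟨
      qint (suc k) (G k ⊕ qpow 1 G₂)                            ≈⟨ qint-cong (suc k) (M k 2+k≤ℓ) ⟩
      qint (suc k) (qint 2 G₁)                                  ≈⟨ qint-comm (suc k) 2 G₁ ⟩
      qint 2 (qint (suc k) G₁)                                  ≈⟨ qint-2 (qint (suc k) G₁) ⟩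
      (G₁ ⊕ qpow 1 (qint k G₁)) ⊕ qpow 1 (qint (suc k) G₁)      ≈⟨ xy∙z≈xz∙y G₁ _ _ ⟩
      qint (suc (suc k)) G₁ ⊕ qpow 1 (qint k G₁)                ∎)
    where
    G₁ G₂ : Poly
    G₁ = G (suc k)
    G₂ = G (suc (suc k))

  -- Differences can be chained without subtraction: if a₁ - a₂ = r₂ - r₁ = p₀ - p
  -- then a₁ - a₂ = p₀ - p.
  ⊕-transfer : ∀ {a₁ a₂ r₁ r₂ p p₀} → (a₁ ⊕ r₁) ≐ (a₂ ⊕ r₂) → (r₂ ⊕ p) ≐ (r₁ ⊕ p₀) →
               (a₁ ⊕ p) ≐ (a₂ ⊕ p₀)
  ⊕-transfer {a₁} {a₂} {r₁} {r₂} {p} {p₀} e₁ e₂ = ⊕-cancelʳ (r₁ ⊕ r₂) (begin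
    (a₁ ⊕ p) ⊕ (r₁ ⊕ r₂)    ≈⟨ ⊕-interchange a₁ p r₁ r₂ ⟩
    (a₁ ⊕ r₁) ⊕ (p ⊕ r₂)    ≈⟨ ⊕-cong e₁ (⊕-comm p r₂) ⟩
    (a₂ ⊕ r₂) ⊕ (r₂ ⊕ p)    ≈⟨ ⊕-congˡ (a₂ ⊕ r₂) e₂ ⟩
    (a₂ ⊕ r₂) ⊕ (r₁ ⊕ p₀)   ≈⟨ ⊕-congˡ (a₂ ⊕ r₂) (⊕-comm r₁ p₀) ⟩
    (a₂ ⊕ r₂) ⊕ (p₀ ⊕ r₁)   ≈⟨ ⊕-interchange a₂ r₂ p₀ r₁ ⟩
    (a₂ ⊕ p₀) ⊕ (r₂ ⊕ r₁)   ≈⟨ ⊕-congˡ (a₂ ⊕ p₀) (⊕-comm r₂ r₁) ⟩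
    (a₂ ⊕ p₀) ⊕ (r₁ ⊕ r₂)   ∎)

  -- [ℓ]_q (G_j - G_{j+1}) = q^e (G_0 - G_ℓ) whenever j + 1 + e = ℓ, by induction on e:
  -- the case e = 0 is (a) for k = ℓ - 1, and the step combines [ℓ]_q times the j-th
  -- modular relation with q times the statement for j + 1.
  differenceRelation : ∀ {G ℓ} → ModularUpTo G ℓ → ∀ e j → suc (e + j) ≡ ℓ →
              (qint ℓ (G j) ⊕ qpow e (G ℓ)) ≐ (qint ℓ (G (suc j)) ⊕ qpow e (G 0))
  differenceRelation {G} M zero    j refl = begin
    qint (suc j) (G j) ⊕ G (suc j)                            ≈⟨ ⊕-congʳ (G (suc j)) (relationA M j ≤-refl) ⟨
    (G 0 ⊕ qpow 1 (qint j (G (suc j)))) ⊕ G (suc j)           ≈⟨ xy∙z≈zy∙x (G 0) _ _ ⟩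
    (G (suc j) ⊕ qpow 1 (qint j (G (suc j)))) ⊕ G 0           ∎
  differenceRelation {G} M (suc e) j refl =
    ⊕-transfer {r₁ = qpow 1 (qint L (G (2 + j)))} {r₂ = qpow 1 (qint L (G (suc j)))}
               multipliedModular shiftedRelation
    where
    L : ℕ
    L = suc (suc (e + j))
    multipliedModular : (qint L (G j) ⊕ qpow 1 (qint L (G (2 + j))))
                     ≐ (qint L (G (suc j)) ⊕ qpow 1 (qint L (G (suc j))))
    multipliedModular = begin
      qint L (G j) ⊕ qpow 1 (qint L (G (2 + j)))              ≈⟨ ⊕-congˡ (qint L (G j)) (qpow-qint 1 L (G (2 + j))) ⟩
      qint L (G j) ⊕ qint L (qpow 1 (G (2 + j)))              ≈⟨ qint-⊕ L (G j) _ ⟨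
      qint L (G j ⊕ qpow 1 (G (2 + j)))                       ≈⟨ qint-cong L (M j (s≤s (s≤s (m≤n+m j e)))) ⟩
      qint L (qint 2 (G (suc j)))                             ≈⟨ qint-cong L (qint-2 (G (suc j))) ⟩
      qint L (G (suc j) ⊕ qpow 1 (G (suc j)))                 ≈⟨ qint-⊕ L (G (suc j)) _ ⟩
      qint L (G (suc j)) ⊕ qint L (qpow 1 (G (suc j)))        ≈⟨ ⊕-congˡ (qint L (G (suc j))) (qpow-qint 1 L (G (suc j))) ⟨
      qint L (G (suc j)) ⊕ qpow 1 (qint L (G (suc j)))        ∎
    shiftedRelation : (qpow 1 (qint L (G (suc j))) ⊕ qpow (suc e) (G L))
                    ≐ (qpow 1 (qint L (G (2 + j))) ⊕ qpow (suc e) (G 0))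
    shiftedRelation = begin
      qpow 1 (qint L (G (suc j))) ⊕ qpow (suc e) (G L)        ≈⟨ ⊕-congˡ (qpow 1 (qint L (G (suc j)))) (qpow-qpow 1 e (G L)) ⟨
      qpow 1 (qint L (G (suc j))) ⊕ qpow 1 (qpow e (G L))     ≈⟨ qpow-⊕ 1 _ _ ⟨
      qpow 1 (qint L (G (suc j)) ⊕ qpow e (G L))
        ≈⟨ qpow-cong 1 (differenceRelation M e (suc j) (cong suc (+-suc e j))) ⟩
      qpow 1 (qint L (G (2 + j)) ⊕ qpow e (G 0))              ≈⟨ qpow-⊕ 1 _ _ ⟩
      qpow 1 (qint L (G (2 + j))) ⊕ qpow 1 (qpow e (G 0))     ≈⟨ ⊕-congˡ (qpow 1 (qint L (G (2 + j)))) (qpow-qpow 1 e (G 0)) ⟩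
      qpow 1 (qint L (G (2 + j))) ⊕ qpow (suc e) (G 0)        ∎

  -- Identity (b): [e]_q G_0 + q^e [k]_q G_ℓ = [ℓ]_q G_k whenever k + e = ℓ, by induction
  -- on k, using (b) for (k, e + 1) and differenceRelation for (e, k).
  relationB : ∀ {G ℓ} → ModularUpTo G ℓ → ∀ k e → k + e ≡ ℓ →
              (qint e (G 0) ⊕ qpow e (qint k (G ℓ))) ≐ qint ℓ (G k)
  relationB {G} M zero    e refl = begin
    qint e (G 0) ⊕ qpow e (qint 0 (G e))  ≈⟨ ⊕-congˡ (qint e (G 0)) (qpow-0P e) ⟩
    qint e (G 0) ⊕ 0P                     ≈⟨ (λ d → +-identityʳ (qint e (G 0) d)) ⟩
    qint e (G 0)                          ∎
  relationB {G} {ℓ} M (suc k) e k+e≡ℓ = ⊕-cancelʳ (qpow e (G 0)) (begin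
    (qint e (G 0) ⊕ qpow e (qint (suc k) Gℓ)) ⊕ qpow e (G 0)
        ≈⟨ ⊕-congʳ (qpow e (G 0)) (⊕-congˡ (qint e (G 0)) (qpow-⊕ e Gℓ (qpow 1 (qint k Gℓ)))) ⟩
    (qint e (G 0) ⊕ (qpow e Gℓ ⊕ qpow e (qpow 1 (qint k Gℓ)))) ⊕ qpow e (G 0)
        ≈⟨ shuffle (qint e (G 0)) (qpow e Gℓ) _ (qpow e (G 0)) ⟩
    ((qint e (G 0) ⊕ qpow e (G 0)) ⊕ qpow e (qpow 1 (qint k Gℓ))) ⊕ qpow e Gℓ
        ≈⟨ ⊕-congʳ (qpow e Gℓ) (⊕-cong (≐-sym (qint-sucʳ e (G 0))) (qpow-comm e 1 (qint k Gℓ))) ⟩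
    (qint (suc e) (G 0) ⊕ qpow 1 (qpow e (qint k Gℓ))) ⊕ qpow e Gℓ
        ≈⟨ ⊕-congʳ (qpow e Gℓ) (⊕-congˡ (qint (suc e) (G 0)) (qpow-qpow 1 e (qint k Gℓ))) ⟩
    (qint (suc e) (G 0) ⊕ qpow (suc e) (qint k Gℓ)) ⊕ qpow e Gℓ
        ≈⟨ ⊕-congʳ (qpow e Gℓ) (relationB M k (suc e) (trans (+-suc k e) k+e≡ℓ)) ⟩
    qint ℓ (G k) ⊕ qpow e Gℓ
        ≈⟨ differenceRelation M e k (trans (cong suc (+-comm e k)) k+e≡ℓ) ⟩
    qint ℓ (G (suc k)) ⊕ qpow e (G 0)
        ∎)
    where
    Gℓ : Poly
    Gℓ = G ℓ
    shuffle : ∀ a b c d → ((a ⊕ (b ⊕ c)) ⊕ d) ≐ (((a ⊕ d) ⊕ c) ⊕ b)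
    shuffle a b c d = begin
      (a ⊕ (b ⊕ c)) ⊕ d    ≈⟨ ⊕-congʳ d (⊕-congˡ a (⊕-comm b c)) ⟩
      (a ⊕ (c ⊕ b)) ⊕ d    ≈⟨ ⊕-congʳ d (⊕-assoc a c b) ⟨
      ((a ⊕ c) ⊕ b) ⊕ d    ≈⟨ xy∙z≈xz∙y (a ⊕ c) b d ⟩
      ((a ⊕ c) ⊕ d) ⊕ b    ≈⟨ ⊕-congʳ b (xy∙z≈xz∙y a c d) ⟩
      ((a ⊕ d) ⊕ c) ⊕ b    ∎

_≟²_ : ∀ {n} → DecidableEquality (Fin n × Fin n)
(j , l) ≟² (x , y) = map′ (uncurry (cong₂ _,_)) ,-injective (j FinP.≟ x ×-dec l FinP.≟ y)

once-pairs : ∀ n → Once _≟²_ (pairs n)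
once-pairs n = exactlyOnce λ { (x , y) → begin
  ∑ (pairs n) (λ p → 𝟙 (p ≟² (x , y)))
    ≡⟨ ∑-cartesianProduct (allFin n) (allFin n) _ ⟩
  ∑ (allFin n) (λ j → ∑ (allFin n) (λ l → 𝟙 ((j , l) ≟² (x , y))))
    ≡⟨ ∑-cong (allFin n) (λ j → ∑-cong (allFin n) (λ l → bit-∧ (does (j FinP.≟ x)) (does (l FinP.≟ y)))) ⟩
  ∑ (allFin n) (λ j → ∑ (allFin n) (λ l → 𝟙 (j FinP.≟ x) * 𝟙 (l FinP.≟ y)))
    ≡⟨ once-∑∑ (once-allFin n) (once-allFin n) x y ⟩
  1 ∎ }
  where open ≡-Reasoning

_≟ᶜ_ : ∀ {n m} → DecidableEquality (Vec (Fin m) n)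
_≟ᶜ_ = VecP.≡-dec FinP._≟_

once-allMaps : ∀ n m → Once _≟ᶜ_ (allMaps n m)
once-allMaps n m = exactlyOnce (occurrencesOf n m)
  where
  occurrencesOf : ∀ n m (κ : Vec (Fin m) n) → ∑ (allMaps n m) (λ θ → 𝟙 (θ ≟ᶜ κ)) ≡ 1
  occurrencesOf zero    m []      = refl
  occurrencesOf (suc n) m (d ∷ κ) = begin
    ∑ (allMaps (suc n) m) (λ θ → 𝟙 (θ ≟ᶜ (d ∷ κ)))
      ≡⟨ ∑-concatMap _ (allFin m) _ ⟩
    ∑ (allFin m) (λ c → ∑ (List.map (c ∷_) (allMaps n m)) (λ θ → 𝟙 (θ ≟ᶜ (d ∷ κ))))
      ≡⟨ ∑-cong (allFin m) (λ c → ∑-map (c ∷_) (allMaps n m) _) ⟩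
    ∑ (allFin m) (λ c → ∑ (allMaps n m) (λ θ → 𝟙 ((c ∷ θ) ≟ᶜ (d ∷ κ))))
      ≡⟨ ∑-cong (allFin m) (λ c → ∑-cong (allMaps n m) (λ θ → bit-∧ (does (c FinP.≟ d)) (does (θ ≟ᶜ κ)))) ⟩
    ∑ (allFin m) (λ c → ∑ (allMaps n m) (λ θ → 𝟙 (c FinP.≟ d) * 𝟙 (θ ≟ᶜ κ)))
      ≡⟨ once-∑∑ (once-allFin m) (once-allMaps n m) d κ ⟩
    1 ∎
    where open ≡-Reasoning

edge : (ℕ → ℕ) → ∀ {n} → Fin n × Fin n → ℕ
edge b (j , l) = 𝟙 (edgeLt? b j l)

lt : ∀ {m} → Fin m → Fin m → ℕ
lt c c' = 𝟙 (toℕ c <? toℕ c')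

eq : ∀ {m} → Fin m → Fin m → ℕ
eq c c' = 𝟙 (c FinP.≟ c')

edgeCount : (ℕ → ℕ) → ∀ {n m} → (Fin m → Fin m → ℕ) → Vec (Fin m) n → ℕ
edgeCount b {n} R κ = ∑ (pairs n) (λ p → edge b p * R (lookup κ (proj₁ p)) (lookup κ (proj₂ p)))

asc-edgeCount : ∀ b {n m} (κ : Vec (Fin m) n) → asc b κ ≡ edgeCount b lt κ
asc-edgeCount b {n} κ =
  trans (length-filter _ (pairs n)) (∑-cong (pairs n) (λ p → bit-∧ (does (edgeLt? b (proj₁ p) (proj₂ p))) _))

violations : (ℕ → ℕ) → ∀ {n m} → Vec (Fin m) n → ℕ
violations b κ = edgeCount b eq κ

whenZero : ℕ → ℕ → ℕ
whenZero zero    t = t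
whenZero (suc _) t = 0

𝟙-all : ∀ {a} {A : Set a} {E D : A → Set} (E? : ∀ x → Dec (E x)) (D? : ∀ x → Dec (D x)) xs t →
        𝟙 (all? (λ x → E? x →-dec ¬? (D? x)) xs) * t ≡ whenZero (∑ xs (λ x → 𝟙 (E? x) * 𝟙 (D? x))) t
𝟙-all E? D? []       t = +-identityʳ t
𝟙-all E? D? (x ∷ xs) t with does (E? x) | does (D? x)
... | true  | true  = refl
... | true  | false = 𝟙-all E? D? xs t
... | false | _     = 𝟙-all E? D? xs t

proper-violations : ∀ b {n m} (κ : Vec (Fin m) n) t → 𝟙 (proper? b κ) * t ≡ whenZero (violations b κ) t
proper-violations b {n} κ t =
  𝟙-all (λ p → edgeLt? b (proj₁ p) (proj₂ p)) (λ p → lookup κ (proj₁ p) FinP.≟ lookup κ (proj₂ p)) (pairs n) t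

edgeCount-extra : ∀ b b' {n} (x : Fin n × Fin n) → (∀ p → edge b p ≡ 𝟙 (p ≟² x) + edge b' p) →
                  ∀ {m} (R : Fin m → Fin m → ℕ) (κ : Vec (Fin m) n) →
                  edgeCount b R κ ≡ R (lookup κ (proj₁ x)) (lookup κ (proj₂ x)) + edgeCount b' R κ
edgeCount-extra b b' {n} x extra R κ = Enumeration.extract _≟²_ (pairs n) (once-pairs n) x _ _ _ extra

-- span x t r = [x < t ≤ x + r]: vertex t is one of the r vertices after x.
-- By definition edge b (j , l) = span (toℕ j) (toℕ l) (b (suc (toℕ j))).
span : ℕ → ℕ → ℕ → ℕ
span x t r = 𝟙 ((x <? t) ×-dec (t ≤? x + r))

span-suc : ∀ x t r (d : Dec (t ≡ x + suc r)) → span x t (suc r) ≡ 𝟙 d + span x t r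
span-suc x t r (yes refl) =
  trans (𝟙-yes (x<x+1+r , ≤-refl) ((x <? x + suc r) ×-dec (x + suc r ≤? x + suc r)))
        (cong suc (sym (𝟙-no (λ h → +-suc-≰ (proj₂ h)) ((x <? x + suc r) ×-dec (x + suc r ≤? x + r)))))
  where
  x<x+1+r : x < x + suc r
  x<x+1+r = ≤-trans (s≤s (m≤m+n x r)) (≤-reflexive (sym (+-suc x r)))
  +-suc-≰ : ¬ (x + suc r ≤ x + r)
  +-suc-≰ h = n≮n (x + r) (≤-trans (≤-reflexive (sym (+-suc x r))) h)
span-suc x t r (no t≢) =
  𝟙-⇔ (λ (x<t , t≤) → x<t , shrink t≤) (λ (x<t , t≤) → x<t , ≤-trans t≤ (+-monoʳ-≤ x (n≤1+n r)))
      ((x <? t) ×-dec (t ≤? x + suc r)) ((x <? t) ×-dec (t ≤? x + r))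
  where
  shrink : t ≤ x + suc r → t ≤ x + r
  shrink t≤ = s≤s⁻¹ (≤-trans (≤∧≢⇒< t≤ t≢) (≤-reflexive (+-suc x r)))

modify-at : ∀ a i z → modify a i z i ≡ a i ∸ z
modify-at a i z rewrite dec-true (i ≟ i) refl = refl

modify-away : ∀ a i z j → j ≢ i → modify a i z j ≡ a j
modify-away a i z j j≢i rewrite dec-false (j ≟ i) j≢i = refl

module RemoveEdge (a : ℕ → ℕ) (i₀ z : ℕ) (z<aᵢ : z < a (suc i₀)) {n : ℕ} (I W : Fin n)
                  (I≡ : toℕ I ≡ i₀) (W≡ : toℕ W ≡ i₀ + (a (suc i₀) ∸ z)) where

  -- On the row of I the span shrinks by the single vertex W; other rows are unchanged.
  edge-removed : ∀ p → edge (modify a (suc i₀) z) p ≡ 𝟙 (p ≟² (I , W)) + edge (modify a (suc i₀) (suc z)) p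
  edge-removed (j , l) with toℕ j ≟ i₀
  ... | yes j≡ = begin
    span (toℕ j) (toℕ l) (modify a (suc i₀) z (suc (toℕ j)))
      ≡⟨ cong (span (toℕ j) (toℕ l)) (trans (entry z) aᵢ∸z) ⟩
    span (toℕ j) (toℕ l) (suc Q)
      ≡⟨ span-suc (toℕ j) (toℕ l) Q (toℕ l ≟ toℕ j + suc Q) ⟩
    𝟙 (toℕ l ≟ toℕ j + suc Q) + span (toℕ j) (toℕ l) Q
      ≡⟨ cong₂ _+_ (𝟙-⇔ isW isW⁻¹ (toℕ l ≟ toℕ j + suc Q) ((j , l) ≟² (I , W)))
                   (cong (span (toℕ j) (toℕ l)) (sym (entry (suc z)))) ⟩
    𝟙 ((j , l) ≟² (I , W)) + span (toℕ j) (toℕ l) (modify a (suc i₀) (suc z) (suc (toℕ j)))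
      ∎
    where
    open ≡-Reasoning
    Q : ℕ
    Q = a (suc i₀) ∸ suc z
    entry : ∀ y → modify a (suc i₀) y (suc (toℕ j)) ≡ a (suc i₀) ∸ y
    entry y = trans (cong (modify a (suc i₀) y ∘ suc) j≡) (modify-at a (suc i₀) y)
    aᵢ∸z : a (suc i₀) ∸ z ≡ suc Q
    aᵢ∸z = +-∸-assoc 1 z<aᵢ
    W≡' : toℕ W ≡ toℕ j + suc Q
    W≡' = trans W≡ (trans (cong (i₀ +_) aᵢ∸z) (cong (_+ suc Q) (sym j≡)))
    isW : toℕ l ≡ toℕ j + suc Q → (j , l) ≡ (I , W)
    isW l≡ = cong₂ _,_ (FinP.toℕ-injective (trans j≡ (sym I≡))) (FinP.toℕ-injective (trans l≡ (sym W≡')))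
    isW⁻¹ : (j , l) ≡ (I , W) → toℕ l ≡ toℕ j + suc Q
    isW⁻¹ refl = W≡'
  ... | no j≢ = begin
    span (toℕ j) (toℕ l) (modify a (suc i₀) z (suc (toℕ j)))
      ≡⟨ cong (span (toℕ j) (toℕ l))
              (trans (modify-away a (suc i₀) z _ j+1≢) (sym (modify-away a (suc i₀) (suc z) _ j+1≢))) ⟩
    span (toℕ j) (toℕ l) (modify a (suc i₀) (suc z) (suc (toℕ j)))
      ≡⟨ cong (_+ _) (𝟙-no (λ jl≡IW → j≢ (trans (cong (toℕ ∘ proj₁) jl≡IW) I≡)) ((j , l) ≟² (I , W))) ⟨
    𝟙 ((j , l) ≟² (I , W)) + span (toℕ j) (toℕ l) (modify a (suc i₀) (suc z) (suc (toℕ j)))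
      ∎
    where
    open ≡-Reasoning
    j+1≢ : suc (toℕ j) ≢ suc i₀
    j+1≢ e = j≢ (suc-injective e)


first : ∀ {n} {j x l y : Fin n} → j ≢ x → (j , l) ≢ (x , y)
first j≢x e = j≢x (cong proj₁ e)

second : ∀ {n} {j x l y : Fin n} → l ≢ y → (j , l) ≢ (x , y)
second l≢y e = l≢y (cong proj₂ e)

unmatched : ∀ {n} (p q q' : Fin n × Fin n) → p ≢ q → p ≢ q' → 𝟙 (p ≟² q) ≡ 𝟙 (p ≟² q')
unmatched p q q' p≢q p≢q' = trans (𝟙-no p≢q (p ≟² q)) (sym (𝟙-no p≢q' (p ≟² q')))

count-∑ : ∀ {m k} (c : Fin m) (κ : Vec (Fin m) k) →
          count (FinP._≟ c) κ ≡ ∑ (allFin k) (λ x → 𝟙 (lookup κ x FinP.≟ c))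
count-∑ c []            = refl
count-∑ {k = suc k} c (d ∷ κ) with does (d FinP.≟ c)
... | true  = cong suc (trans (count-∑ c κ) (sym (∑-tabulate k Fin.suc _)))
... | false = trans (count-∑ c κ) (sym (∑-tabulate k Fin.suc _))

-- Twin vertices u < v = u + 1 of the graph of b: they are adjacent, have the same last
-- neighbour, and every earlier vertex is adjacent to both of them or to neither.
module Twins (b : ℕ → ℕ) {n : ℕ} (u v : Fin n) (v≡ : toℕ v ≡ suc (toℕ u))
             (earlier : ∀ t → t < toℕ u → t + b (suc t) < toℕ u ⊎ toℕ v ≤ t + b (suc t))
             (sameEnd : toℕ u + b (suc (toℕ u)) ≡ toℕ v + b (suc (toℕ v)))
             (adjacent : toℕ v ≤ toℕ u + b (suc (toℕ u))) where

  private
    U V : ℕ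
    U = toℕ u
    V = toℕ v

    U<V : U < V
    U<V = ≤-reflexive (sym v≡)

  u≢v : u ≢ v
  u≢v u≡v = <⇒≢ U<V (cong toℕ u≡v)

  v≢u : v ≢ u
  v≢u = u≢v ∘ sym

  τ : Fin n → Fin n
  τ x with x FinP.≟ u | x FinP.≟ v
  ... | yes _ | _     = v
  ... | no _  | yes _ = u
  ... | no _  | no _  = x

  data SwapView (x : Fin n) : Fin n → Set where
    atU  : x ≡ u → SwapView x v
    atV  : x ≡ v → SwapView x u
    away : x ≢ u → x ≢ v → SwapView x x

  swapView : ∀ x → SwapView x (τ x)
  swapView x with x FinP.≟ u | x FinP.≟ v
  ... | yes x≡u | _       = atU x≡u
  ... | no _    | yes x≡v = atV x≡v
  ... | no x≢u  | no x≢v  = away x≢u x≢v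

  τ-u : τ u ≡ v
  τ-u with τ u | swapView u
  ... | _ | atU _      = refl
  ... | _ | atV u≡v    = ⊥-elim (u≢v u≡v)
  ... | _ | away u≢u _ = ⊥-elim (u≢u refl)

  τ-v : τ v ≡ u
  τ-v with τ v | swapView v
  ... | _ | atU v≡u    = ⊥-elim (v≢u v≡u)
  ... | _ | atV _      = refl
  ... | _ | away _ v≢v = ⊥-elim (v≢v refl)

  τ-away : ∀ x → x ≢ u → x ≢ v → τ x ≡ x
  τ-away x x≢u x≢v with τ x | swapView x
  ... | _ | atU x≡u  = ⊥-elim (x≢u x≡u)
  ... | _ | atV x≡v  = ⊥-elim (x≢v x≡v)
  ... | _ | away _ _ = refl

  τ-involutive : ∀ x → τ (τ x) ≡ x
  τ-involutive x with τ x | swapView x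
  ... | _ | atU refl       = τ-v
  ... | _ | atV refl       = τ-u
  ... | _ | away x≢u x≢v   = τ-away x x≢u x≢v

  edge-loop : ∀ (x : Fin n) → edge b (x , x) ≡ 0
  edge-loop x = 𝟙-no (λ (x<x , _) → n≮n (toℕ x) x<x) (edgeLt? b x x)

  edge-uv : edge b (u , v) ≡ 1
  edge-uv = 𝟙-yes (U<V , adjacent) (edgeLt? b u v)

  edge-vu : edge b (v , u) ≡ 0
  edge-vu = 𝟙-no (λ (V<U , _) → <-asym V<U U<V) (edgeLt? b v u)

  -- A vertex t ∉ {u, v} after the twins is adjacent to u iff to v (same last neighbour);
  -- one before them likewise (hypothesis earlier).
  edge-fromTwins : ∀ t → t ≢ u → t ≢ v → edge b (v , t) ≡ edge b (u , t)
  edge-fromTwins t t≢u t≢v =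
    𝟙-⇔ (λ (V<t , t≤) → <-trans U<V V<t , ≤-trans t≤ (≤-reflexive (sym sameEnd)))
        (λ (U<t , t≤) → ≤∧≢⇒< (≤-trans (≤-reflexive v≡) U<t) (λ V≡t → t≢v (FinP.toℕ-injective (sym V≡t))) ,
                        ≤-trans t≤ (≤-reflexive sameEnd))
        (edgeLt? b v t) (edgeLt? b u t)

  edge-toTwins : ∀ t → t ≢ u → t ≢ v → edge b (t , v) ≡ edge b (t , u)
  edge-toTwins t t≢u t≢v = 𝟙-⇔ toU toV (edgeLt? b t v) (edgeLt? b t u)
    where
    T : ℕ
    T = toℕ t
    toU : T < V × V ≤ T + b (suc T) → T < U × U ≤ T + b (suc T)
    toU (T<V , V≤) = ≤∧≢⇒< (s≤s⁻¹ (≤-trans T<V (≤-reflexive v≡))) (λ T≡U → t≢u (FinP.toℕ-injective T≡U)) ,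
                     ≤-trans (n≤1+n U) (≤-trans (≤-reflexive (sym v≡)) V≤)
    toV : T < U × U ≤ T + b (suc T) → T < V × V ≤ T + b (suc T)
    toV (T<U , U≤) with earlier T T<U
    ... | inj₁ end<U = ⊥-elim (<-irrefl refl (<-≤-trans end<U U≤))
    ... | inj₂ V≤    = <-trans T<U (≤-reflexive (sym v≡)) , V≤

  τ² : Fin n × Fin n → Fin n × Fin n
  τ² (j , l) = τ j , τ l

  τ²-involutive : ∀ p → τ² (τ² p) ≡ p
  τ²-involutive (j , l) = cong₂ _,_ (τ-involutive j) (τ-involutive l)

  swapped-edges : ∀ p → 𝟙 (p ≟² (u , v)) + edge b (τ² p) ≡ 𝟙 (p ≟² (v , u)) + edge b p
  swapped-edges (j , l) with τ j | swapView j | τ l | swapView l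
  ... | _ | atU refl | _ | atU refl =
    cong₂ _+_ (unmatched (u , u) (u , v) (v , u) (second u≢v) (first u≢v)) (trans (edge-loop v) (sym (edge-loop u)))
  ... | _ | atU refl | _ | atV refl =
    trans (cong₂ _+_ (𝟙-yes refl ((u , v) ≟² (u , v))) edge-vu)
                                            (sym (cong₂ _+_ (𝟙-no (first u≢v) ((u , v) ≟² (v , u))) edge-uv))
  ... | _ | atU refl | _ | away l≢u l≢v =
    cong₂ _+_ (unmatched (u , l) (u , v) (v , u) (second l≢v) (first u≢v)) (edge-fromTwins l l≢u l≢v)
  ... | _ | atV refl | _ | atU refl =
    trans (cong₂ _+_ (𝟙-no (first v≢u) ((v , u) ≟² (u , v))) edge-uv)
                                            (sym (cong₂ _+_ (𝟙-yes refl ((v , u) ≟² (v , u))) edge-vu))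
  ... | _ | atV refl | _ | atV refl =
    cong₂ _+_ (unmatched (v , v) (u , v) (v , u) (first v≢u) (second v≢u)) (trans (edge-loop u) (sym (edge-loop v)))
  ... | _ | atV refl | _ | away l≢u l≢v =
    cong₂ _+_ (unmatched (v , l) (u , v) (v , u) (first v≢u) (second l≢u)) (sym (edge-fromTwins l l≢u l≢v))
  ... | _ | away j≢u j≢v | _ | atU refl =
    cong₂ _+_ (unmatched (j , u) (u , v) (v , u) (first j≢u) (first j≢v)) (edge-toTwins j j≢u j≢v)
  ... | _ | away j≢u j≢v | _ | atV refl =
    cong₂ _+_ (unmatched (j , v) (u , v) (v , u) (first j≢u) (first j≢v)) (sym (edge-toTwins j j≢u j≢v))
  ... | _ | away j≢u j≢v | _ | away _ _ =
    cong₂ _+_ (unmatched (j , l) (u , v) (v , u) (first j≢u) (first j≢v)) refl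

  swap : ∀ {m} → Vec (Fin m) n → Vec (Fin m) n
  swap κ = tabulate (lookup κ ∘ τ)

  lookup-swap : ∀ {m} (κ : Vec (Fin m) n) x → lookup (swap κ) x ≡ lookup κ (τ x)
  lookup-swap κ = VecP.lookup∘tabulate (lookup κ ∘ τ)

  swap-involutive : ∀ {m} (κ : Vec (Fin m) n) → swap (swap κ) ≡ κ
  swap-involutive κ = trans (VecP.tabulate-cong (λ x → trans (lookup-swap κ (τ x)) (cong (lookup κ) (τ-involutive x))))
                            (VecP.tabulate∘lookup κ)

  content-swap : ∀ {m} (κ : Vec (Fin m) n) → content (swap κ) ≡ content κ
  content-swap κ = VecP.tabulate-cong λ c → begin
    count (FinP._≟ c) (swap κ)                            ≡⟨ count-∑ c (swap κ) ⟩
    ∑ (allFin n) (λ x → 𝟙 (lookup (swap κ) x FinP.≟ c))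
      ≡⟨ ∑-cong (allFin n) (λ x → cong (λ d → 𝟙 (d FinP.≟ c)) (lookup-swap κ x)) ⟩
    ∑ (allFin n) (λ x → 𝟙 (lookup κ (τ x) FinP.≟ c))
      ≡⟨ Enumeration.reindex FinP._≟_ (allFin n) (once-allFin n) τ τ-involutive _ ⟩
    ∑ (allFin n) (λ x → 𝟙 (lookup κ x FinP.≟ c))          ≡⟨ count-∑ c κ ⟨
    count (FinP._≟ c) κ                                   ∎
    where open ≡-Reasoning

  edgeCount-swap : ∀ {m} (R : Fin m → Fin m → ℕ) (κ : Vec (Fin m) n) →
                   R (lookup κ u) (lookup κ v) + edgeCount b R (swap κ) ≡ R (lookup κ v) (lookup κ u) + edgeCount b R κ
  edgeCount-swap R κ = begin
    h (u , v) + edgeCount b R (swap κ)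
      ≡⟨ cong (h (u , v) +_) (∑-cong (pairs n) (λ p →
           cong₂ (λ q cc → edge b q * R (proj₁ cc) (proj₂ cc))
                 (sym (τ²-involutive p)) (cong₂ _,_ (lookup-swap κ (proj₁ p)) (lookup-swap κ (proj₂ p))))) ⟩
    h (u , v) + ∑ (pairs n) (λ p → edge b (τ² (τ² p)) * h (τ² p))
      ≡⟨ cong (h (u , v) +_) (E.reindex τ² τ²-involutive (λ p → edge b (τ² p) * h p)) ⟩
    h (u , v) + ∑ (pairs n) (λ p → edge b (τ² p) * h p)
      ≡⟨ E.extract (u , v) _ _ h (λ _ → refl) ⟨
    ∑ (pairs n) (λ p → (𝟙 (p ≟² (u , v)) + edge b (τ² p)) * h p)
      ≡⟨ E.extract (v , u) _ _ h swapped-edges ⟩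
    h (v , u) + edgeCount b R κ
      ∎
    where
    open ≡-Reasoning
    module E = Enumeration _≟²_ (pairs n) (once-pairs n)
    h : Fin n × Fin n → ℕ
    h p = R (lookup κ (proj₁ p)) (lookup κ (proj₂ p))

  edgeCount-uv : ∀ {m} (R : Fin m → Fin m → ℕ) (κ : Vec (Fin m) n) → R (lookup κ u) (lookup κ v) ≤ edgeCount b R κ
  edgeCount-uv R κ = begin
    h (u , v)                                          ≡⟨ Enumeration.sift _≟²_ (pairs n) (once-pairs n) (u , v) h ⟨
    ∑ (pairs n) (λ p → 𝟙 (p ≟² (u , v)) * h p)
      ≤⟨ ∑-mono (pairs n) (λ p → *-monoˡ-≤ (h p) (uv≤edge p (p ≟² (u , v)))) ⟩
    edgeCount b R κ                                    ∎
    where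
    open ≤-Reasoning
    h : Fin n × Fin n → ℕ
    h p = R (lookup κ (proj₁ p)) (lookup κ (proj₂ p))
    uv≤edge : ∀ p (d : Dec (p ≡ (u , v))) → 𝟙 d ≤ edge b p
    uv≤edge p (yes refl) = ≤-reflexive (sym edge-uv)
    uv≤edge p (no _)     = z≤n

swap-pairs : ∀ a b c d → (a + b) + (c + d) ≡ (b + a) + (d + c)
swap-pairs a b c d = cong₂ _+_ (+-comm a b) (+-comm c d)

double-mix : ∀ a b → (a + a) + (b + b) ≡ (b + a) + (b + a)
double-mix a b = trans (+-interchange a a b b) (cong₂ _+_ (+-comm a b) (+-comm a b))

lt-yes : ∀ {m} {c d : Fin m} → toℕ c < toℕ d → lt c d ≡ 1
lt-yes {c = c} {d} c<d = 𝟙-yes c<d (toℕ c <? toℕ d)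

lt-no : ∀ {m} {c d : Fin m} → ¬ toℕ c < toℕ d → lt c d ≡ 0
lt-no {c = c} {d} c≮d = 𝟙-no c≮d (toℕ c <? toℕ d)

eq-yes : ∀ {m} {c d : Fin m} → toℕ c ≡ toℕ d → eq c d ≡ 1
eq-yes {c = c} {d} c≡d = 𝟙-yes (FinP.toℕ-injective c≡d) (c FinP.≟ d)

eq-no : ∀ {m} {c d : Fin m} → toℕ c ≢ toℕ d → eq c d ≡ 0
eq-no {c = c} {d} c≢d = 𝟙-no (λ e → c≢d (cong toℕ e)) (c FinP.≟ d)

-- The indicators [c < x], [c < y], [c = x], [c = y] of a colour c relative to
-- two colours x < y; one constructor for each position of c.
data Profile : ℕ → ℕ → ℕ → ℕ → Set where
  below   : Profile 1 1 0 0
  atLow   : Profile 0 1 1 0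
  between : Profile 0 1 0 0
  atHigh  : Profile 0 0 0 1
  above   : Profile 0 0 0 0

recast : ∀ {p r e f p' r' e' f'} → p ≡ p' → r ≡ r' → e ≡ e' → f ≡ f' → Profile p' r' e' f' → Profile p r e f
recast refl refl refl refl π = π

profile : ∀ {m} (c x y : Fin m) → toℕ x < toℕ y → Profile (lt c x) (lt c y) (eq c x) (eq c y)
profile c x y x<y with <-cmp (toℕ c) (toℕ x)
... | tri< c<x _ _ = recast (lt-yes c<x) (lt-yes (<-trans c<x x<y)) (eq-no (<⇒≢ c<x)) (eq-no (<⇒≢ (<-trans c<x x<y))) below
... | tri≈ _ c≡x _ = recast (lt-no (<-irrefl c≡x)) (lt-yes (subst (_< toℕ y) (sym c≡x) x<y))
                            (eq-yes c≡x) (eq-no (λ c≡y → <-irrefl (trans (sym c≡x) c≡y) x<y)) atLow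
... | tri> _ _ x<c with <-cmp (toℕ c) (toℕ y)
...   | tri< c<y _ _ = recast (lt-no (<-asym x<c)) (lt-yes c<y) (eq-no (>⇒≢ x<c)) (eq-no (<⇒≢ c<y)) between
...   | tri≈ _ c≡y _ = recast (lt-no (<-asym x<c)) (lt-no (<-irrefl c≡y)) (eq-no (>⇒≢ x<c)) (eq-yes c≡y) atHigh
...   | tri> _ _ y<c = recast (lt-no (<-asym x<c)) (lt-no (<-asym y<c)) (eq-no (>⇒≢ x<c)) (eq-no (>⇒≢ y<c)) above

-- Fix a coefficient and let D e be the contribution of a colouring with e ascents.
-- A colouring with a₀ ascents in G₀ and a₂ in G₂ contributes `left D a₀ a₂` to
-- G₀ + q G₂; one with a₁ ascents in G₁ contributes `right D a₁` to [2]_q G₁.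
left : (ℕ → ℕ) → ℕ → ℕ → ℕ
left D a₀ a₂ = D a₀ + D (suc a₂)

right : (ℕ → ℕ) → ℕ → ℕ
right D a₁ = D a₁ + D (suc a₁)

-- The local modular identity for one pair {κ, κ'} of colourings, LLT version; c, x, y
-- are the colours of i, u, v under κ, and κ' exchanges x and y.  Case x < y, where κ
-- has B + 1 ascents in G₂ and κ' has B:
pairLLT-< : ∀ {p r e f} → Profile p r e f → ∀ (D : ℕ → ℕ) B →
  left D (r + (p + suc B)) (suc B) + left D (p + (r + B)) B ≡ right D (p + suc B) + right D (r + B)
pairLLT-< below   D B = swap-pairs (D (3 + B)) (D (2 + B)) (D (2 + B)) (D (1 + B))
pairLLT-< atLow   D B = double-mix (D (2 + B)) (D (1 + B))
pairLLT-< between D B = double-mix (D (2 + B)) (D (1 + B))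
pairLLT-< atHigh  D B = refl
pairLLT-< above   D B = refl

-- Case x = y, where κ and κ' both have B ascents in G₂:
pairLLT-≡ : ∀ (D : ℕ → ℕ) p → p ≤ 1 → ∀ B →
  left D (p + (p + B)) B + left D (p + (p + B)) B ≡ right D (p + B) + right D (p + B)
pairLLT-≡ D zero    _         B = refl
pairLLT-≡ D (suc _) (s≤s z≤n) B = swap-pairs (D (2 + B)) (D (1 + B)) (D (2 + B)) (D (1 + B))

+-comm-both : ∀ a b c d → a + b ≡ c + d → b + a ≡ d + c
+-comm-both a b c d e = trans (+-comm b a) (trans e (+-comm c d))

ascents-< : ∀ {m} {x y : Fin m} {B B'} → toℕ x < toℕ y → lt x y + B' ≡ lt y x + B → B ≡ suc B'
ascents-< {x = x} {y} {B} {B'} x<y exchange = begin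
  B               ≡⟨ cong (_+ B) (lt-no (<-asym x<y)) ⟨
  lt y x + B      ≡⟨ exchange ⟨
  lt x y + B'     ≡⟨ cong (_+ B') (lt-yes x<y) ⟩
  suc B'          ∎
  where open ≡-Reasoning

pairLLT : ∀ {m} (D : ℕ → ℕ) (c x y : Fin m) B B' → lt x y + B' ≡ lt y x + B →
  left D (lt c y + (lt c x + B)) B + left D (lt c x + (lt c y + B')) B'
  ≡ right D (lt c x + B) + right D (lt c y + B')
pairLLT D c x y B B' exchange with <-cmp (toℕ x) (toℕ y)
... | tri< x<y _ _ rewrite ascents-< x<y exchange = pairLLT-< (profile c x y x<y) D B'
... | tri> _ _ y<x rewrite ascents-< y<x (sym exchange) =
  +-comm-both (left D (lt c x + (lt c y + suc B)) (suc B)) (left D (lt c y + (lt c x + B)) B)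
              (right D (lt c y + suc B)) (right D (lt c x + B)) (pairLLT-< (profile c y x y<x) D B)
... | tri≈ _ x≡y _ with FinP.toℕ-injective x≡y
...   | refl rewrite +-cancelˡ-≡ (lt x x) B' B exchange = pairLLT-≡ D (lt c x) (𝟙≤1 (toℕ c <? toℕ x)) B

-- For chromatic quasisymmetric functions a colouring contributes only when it has no
-- monochromatic edge; v₀, v₁, v₂ count its monochromatic edges in G₀, G₁, G₂.
leftX : (ℕ → ℕ) → ℕ → ℕ → ℕ → ℕ → ℕ
leftX D v₀ a₀ v₂ a₂ = whenZero v₀ (D a₀) + whenZero v₂ (D (suc a₂))

rightX : (ℕ → ℕ) → ℕ → ℕ → ℕ
rightX D v₁ a₁ = whenZero v₁ (D a₁) + whenZero v₁ (D (suc a₁))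

-- Case x < y: ascents in G₂ as for LLT, and κ, κ' have the same number V of
-- monochromatic edges in G₂.
pairX-< : ∀ {p r e f} → Profile p r e f → ∀ (D : ℕ → ℕ) B V →
  leftX D (f + (e + V)) (r + (p + suc B)) V (suc B) + leftX D (e + (f + V)) (p + (r + B)) V B
  ≡ rightX D (e + V) (p + suc B) + rightX D (f + V) (r + B)
pairX-< below   D B zero    = swap-pairs (D (3 + B)) (D (2 + B)) (D (2 + B)) (D (1 + B))
pairX-< atLow   D B zero    = +-comm (D (2 + B)) (D (1 + B))
pairX-< between D B zero    = double-mix (D (2 + B)) (D (1 + B))
pairX-< atHigh  D B zero    = trans (+-comm (D (2 + B)) (D (1 + B))) (sym (+-identityʳ (D (1 + B) + D (2 + B))))
pairX-< above   D B zero    = refl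
pairX-< below   D B (suc V) = refl
pairX-< atLow   D B (suc V) = refl
pairX-< between D B (suc V) = refl
pairX-< atHigh  D B (suc V) = refl
pairX-< above   D B (suc V) = refl

-- Case x = y: the edge {u, v} of G₂ is monochromatic (V ≥ 1), so nothing contributes.
pairX-≡ : ∀ (D : ℕ → ℕ) p e B V → 1 ≤ V →
  leftX D (e + (e + V)) (p + (p + B)) V B + leftX D (e + (e + V)) (p + (p + B)) V B
  ≡ rightX D (e + V) (p + B) + rightX D (e + V) (p + B)
pairX-≡ D p e B (suc k) _ rewrite +-suc e k | +-suc e (e + k) = refl

monochrome-≢ : ∀ {m} {x y : Fin m} {V V'} → toℕ x ≢ toℕ y → eq x y + V' ≡ eq y x + V → V' ≡ V
monochrome-≢ {x = x} {y} {V} {V'} x≢y exchange = begin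
  V'           ≡⟨ cong (_+ V') (eq-no x≢y) ⟨
  eq x y + V'  ≡⟨ exchange ⟩
  eq y x + V   ≡⟨ cong (_+ V) (eq-no (x≢y ∘ sym)) ⟩
  V            ∎
  where open ≡-Reasoning

pairX : ∀ {m} (D : ℕ → ℕ) (c x y : Fin m) B B' V V' →
  lt x y + B' ≡ lt y x + B → eq x y + V' ≡ eq y x + V → eq x y ≤ V →
  leftX D (eq c y + (eq c x + V)) (lt c y + (lt c x + B)) V B
    + leftX D (eq c x + (eq c y + V')) (lt c x + (lt c y + B')) V' B'
  ≡ rightX D (eq c x + V) (lt c x + B) + rightX D (eq c y + V') (lt c y + B')
pairX D c x y B B' V V' exchangeB exchangeV uv with <-cmp (toℕ x) (toℕ y)
... | tri< x<y _ _ rewrite ascents-< x<y exchangeB | monochrome-≢ (<⇒≢ x<y) exchangeV =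
  pairX-< (profile c x y x<y) D B' V
... | tri> _ _ y<x rewrite ascents-< y<x (sym exchangeB) | monochrome-≢ (>⇒≢ y<x) exchangeV =
  +-comm-both (leftX D (eq c x + (eq c y + V)) (lt c x + (lt c y + suc B)) V (suc B))
              (leftX D (eq c y + (eq c x + V)) (lt c y + (lt c x + B)) V B)
              (rightX D (eq c y + V) (lt c y + suc B)) (rightX D (eq c x + V) (lt c x + B))
              (pairX-< (profile c y x y<x) D B V)
... | tri≈ _ x≡y _ with FinP.toℕ-injective x≡y
...   | refl rewrite +-cancelˡ-≡ (lt x x) B' B exchangeB | +-cancelˡ-≡ (eq x x) V' V exchangeV =
  pairX-≡ D (lt c x) (eq c x) B V (≤-trans (≤-reflexive (sym (eq-yes {c = x} refl))) uv)

weight : ∀ {m} → Vec ℕ m → ℕ → Vec ℕ m → ℕ → ℕ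
weight α d w e = 𝟙 (VecP.≡-dec _≟_ w α) * 𝟙 (e ≟ d)

qpow1-∑ : ∀ {A : Set} {m} (α : Vec ℕ m) (P : Poly) (L : List A) (w : A → Vec ℕ m) (e : A → ℕ)
          (G : A → ℕ → ℕ) → (∀ x → G x 0 ≡ 0) →
          (∀ d → P d ≡ ∑ L (λ x → G x (weight α d (w x) (e x)))) →
          ∀ d → qpow 1 P d ≡ ∑ L (λ x → G x (weight α d (w x) (suc (e x))))
qpow1-∑ α P L w e G G0 P≡ zero    =
  sym (trans (∑-cong L (λ x → trans (cong (G x) (*-zeroʳ (𝟙 (VecP.≡-dec _≟_ (w x) α)))) (G0 x))) (∑-zero L))
qpow1-∑ α P L w e G G0 P≡ (suc d) = P≡ d

whenZero-0 : ∀ v → whenZero v 0 ≡ 0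
whenZero-0 zero    = refl
whenZero-0 (suc _) = refl

module _ (n : ℕ) (b : ℕ → ℕ) (m : ℕ) (α : Vec ℕ m) where

  private
    content≟ : (κ : Vec (Fin m) n) → Dec (content κ ≡ α)
    content≟ κ = VecP.≡-dec _≟_ (content κ) α

  LLT-∑ : ∀ d → LLTcoef n b m α d ≡ ∑ (allMaps n m) (λ κ → weight α d (content κ) (asc b κ))
  LLT-∑ d = trans (length-filter _ (allMaps n m))
                  (∑-cong (allMaps n m) (λ κ → bit-∧ (does (content≟ κ)) (does (asc b κ ≟ d))))

  X-∑ : ∀ d → Xcoef n b m α d ≡ ∑ (allMaps n m) (λ κ → whenZero (violations b κ) (weight α d (content κ) (asc b κ)))
  X-∑ d = trans (length-filter _ (allMaps n m)) (∑-cong (allMaps n m) λ κ →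
    trans (bit-∧ (does (proper? b κ)) (does (content≟ κ ×-dec asc b κ ≟ d)))
          (trans (cong (𝟙 (proper? b κ) *_) (bit-∧ (does (content≟ κ)) (does (asc b κ ≟ d))))
                 (proper-violations b κ (weight α d (content κ) (asc b κ)))))

  qLLT-∑ : ∀ d → qpow 1 (LLTcoef n b m α) d ≡ ∑ (allMaps n m) (λ κ → weight α d (content κ) (suc (asc b κ)))
  qLLT-∑ = qpow1-∑ α _ (allMaps n m) content (asc b) (λ _ t → t) (λ _ → refl) LLT-∑

  qX-∑ : ∀ d → qpow 1 (Xcoef n b m α) d
             ≡ ∑ (allMaps n m) (λ κ → whenZero (violations b κ) (weight α d (content κ) (suc (asc b κ))))
  qX-∑ = qpow1-∑ α _ (allMaps n m) content (asc b) (whenZero ∘ violations b) (whenZero-0 ∘ violations b) X-∑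

module ModularLaw (b₀ b₁ b₂ : ℕ → ℕ) {n : ℕ} (I u v : Fin n) (v≡ : toℕ v ≡ suc (toℕ u))
  (earlier : ∀ t → t < toℕ u → t + b₂ (suc t) < toℕ u ⊎ toℕ v ≤ t + b₂ (suc t))
  (sameEnd : toℕ u + b₂ (suc (toℕ u)) ≡ toℕ v + b₂ (suc (toℕ v)))
  (adjacent : toℕ v ≤ toℕ u + b₂ (suc (toℕ u)))
  (I≢u : I ≢ u) (I≢v : I ≢ v)
  (extra-v : ∀ p → edge b₀ p ≡ 𝟙 (p ≟² (I , v)) + edge b₁ p)
  (extra-u : ∀ p → edge b₁ p ≡ 𝟙 (p ≟² (I , u)) + edge b₂ p) where

  open Twins b₂ u v v≡ earlier sameEnd adjacent

  module _ {m : ℕ} (κ : Vec (Fin m) n) (R : Fin m → Fin m → ℕ) where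
    private
      c x y : Fin m
      c = lookup κ I
      x = lookup κ u
      y = lookup κ v
      swap-I : lookup (swap κ) I ≡ c
      swap-I = trans (lookup-swap κ I) (cong (lookup κ) (τ-away I I≢u I≢v))
      swap-u : lookup (swap κ) u ≡ y
      swap-u = trans (lookup-swap κ u) (cong (lookup κ) τ-u)
      swap-v : lookup (swap κ) v ≡ x
      swap-v = trans (lookup-swap κ v) (cong (lookup κ) τ-v)

    count₁ : edgeCount b₁ R κ ≡ R c x + edgeCount b₂ R κ
    count₁ = edgeCount-extra b₁ b₂ (I , u) extra-u R κ

    count₀ : edgeCount b₀ R κ ≡ R c y + (R c x + edgeCount b₂ R κ)
    count₀ = trans (edgeCount-extra b₀ b₁ (I , v) extra-v R κ) (cong (R c y +_) count₁)

    count₁-swap : edgeCount b₁ R (swap κ) ≡ R c y + edgeCount b₂ R (swap κ)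
    count₁-swap = trans (edgeCount-extra b₁ b₂ (I , u) extra-u R (swap κ))
                        (cong (_+ edgeCount b₂ R (swap κ)) (cong₂ R swap-I swap-u))

    count₀-swap : edgeCount b₀ R (swap κ) ≡ R c x + (R c y + edgeCount b₂ R (swap κ))
    count₀-swap = trans (edgeCount-extra b₀ b₁ (I , v) extra-v R (swap κ))
                        (cong₂ _+_ (cong₂ R swap-I swap-v) count₁-swap)

  module _ (m : ℕ) (α : Vec ℕ m) where

    orbit-LLT : ∀ d (κ : Vec (Fin m) n) →
      left (weight α d (content κ)) (asc b₀ κ) (asc b₂ κ)
        + left (weight α d (content (swap κ))) (asc b₀ (swap κ)) (asc b₂ (swap κ))
      ≡ right (weight α d (content κ)) (asc b₁ κ) + right (weight α d (content (swap κ))) (asc b₁ (swap κ))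
    orbit-LLT d κ
      rewrite content-swap κ
            | asc-edgeCount b₀ κ | asc-edgeCount b₁ κ | asc-edgeCount b₂ κ
            | asc-edgeCount b₀ (swap κ) | asc-edgeCount b₁ (swap κ) | asc-edgeCount b₂ (swap κ)
            | count₀ κ lt | count₁ κ lt | count₀-swap κ lt | count₁-swap κ lt
      = pairLLT (weight α d (content κ)) (lookup κ I) (lookup κ u) (lookup κ v)
                (edgeCount b₂ lt κ) (edgeCount b₂ lt (swap κ)) (edgeCount-swap lt κ)

    orbit-X : ∀ d (κ : Vec (Fin m) n) →
      leftX (weight α d (content κ)) (violations b₀ κ) (asc b₀ κ) (violations b₂ κ) (asc b₂ κ)
        + leftX (weight α d (content (swap κ))) (violations b₀ (swap κ)) (asc b₀ (swap κ))
                (violations b₂ (swap κ)) (asc b₂ (swap κ))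
      ≡ rightX (weight α d (content κ)) (violations b₁ κ) (asc b₁ κ)
        + rightX (weight α d (content (swap κ))) (violations b₁ (swap κ)) (asc b₁ (swap κ))
    orbit-X d κ
      rewrite content-swap κ
            | asc-edgeCount b₀ κ | asc-edgeCount b₁ κ | asc-edgeCount b₂ κ
            | asc-edgeCount b₀ (swap κ) | asc-edgeCount b₁ (swap κ) | asc-edgeCount b₂ (swap κ)
            | count₀ κ lt | count₁ κ lt | count₀-swap κ lt | count₁-swap κ lt
            | count₀ κ eq | count₁ κ eq | count₀-swap κ eq | count₁-swap κ eq
      = pairX (weight α d (content κ)) (lookup κ I) (lookup κ u) (lookup κ v)
              (edgeCount b₂ lt κ) (edgeCount b₂ lt (swap κ)) (edgeCount b₂ eq κ) (edgeCount b₂ eq (swap κ))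
              (edgeCount-swap lt κ) (edgeCount-swap eq κ) (edgeCount-uv eq κ)

    private
      maps : List (Vec (Fin m) n)
      maps = allMaps n m
      module E = Enumeration _≟ᶜ_ maps (once-allMaps n m)

    modular-LLT : (LLTcoef n b₀ m α ⊕ qpow 1 (LLTcoef n b₂ m α)) ≐ qint 2 (LLTcoef n b₁ m α)
    modular-LLT d = begin
      LLTcoef n b₀ m α d + qpow 1 (LLTcoef n b₂ m α) d
        ≡⟨ cong₂ _+_ (LLT-∑ n b₀ m α d) (qLLT-∑ n b₂ m α d) ⟩
      ∑ maps (λ κ → weight α d (content κ) (asc b₀ κ)) + ∑ maps (λ κ → weight α d (content κ) (suc (asc b₂ κ)))
        ≡⟨ ∑-+ maps _ _ ⟨
      ∑ maps (λ κ → left (weight α d (content κ)) (asc b₀ κ) (asc b₂ κ))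
        ≡⟨ E.pairing swap swap-involutive _ _ (orbit-LLT d) ⟩
      ∑ maps (λ κ → right (weight α d (content κ)) (asc b₁ κ))
        ≡⟨ ∑-+ maps _ _ ⟩
      ∑ maps (λ κ → weight α d (content κ) (asc b₁ κ)) + ∑ maps (λ κ → weight α d (content κ) (suc (asc b₁ κ)))
        ≡⟨ cong₂ _+_ (LLT-∑ n b₁ m α d) (qLLT-∑ n b₁ m α d) ⟨
      LLTcoef n b₁ m α d + qpow 1 (LLTcoef n b₁ m α) d
        ≡⟨ qint-2 (LLTcoef n b₁ m α) d ⟨
      qint 2 (LLTcoef n b₁ m α) d
        ∎
      where open ≡-Reasoning

    modular-X : (Xcoef n b₀ m α ⊕ qpow 1 (Xcoef n b₂ m α)) ≐ qint 2 (Xcoef n b₁ m α)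
    modular-X d = begin
      Xcoef n b₀ m α d + qpow 1 (Xcoef n b₂ m α) d
        ≡⟨ cong₂ _+_ (X-∑ n b₀ m α d) (qX-∑ n b₂ m α d) ⟩
      ∑ maps (λ κ → whenZero (violations b₀ κ) (weight α d (content κ) (asc b₀ κ)))
        + ∑ maps (λ κ → whenZero (violations b₂ κ) (weight α d (content κ) (suc (asc b₂ κ))))
        ≡⟨ ∑-+ maps _ _ ⟨
      ∑ maps (λ κ → leftX (weight α d (content κ)) (violations b₀ κ) (asc b₀ κ) (violations b₂ κ) (asc b₂ κ))
        ≡⟨ E.pairing swap swap-involutive _ _ (orbit-X d) ⟩
      ∑ maps (λ κ → rightX (weight α d (content κ)) (violations b₁ κ) (asc b₁ κ))
        ≡⟨ ∑-+ maps _ _ ⟩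
      ∑ maps (λ κ → whenZero (violations b₁ κ) (weight α d (content κ) (asc b₁ κ)))
        + ∑ maps (λ κ → whenZero (violations b₁ κ) (weight α d (content κ) (suc (asc b₁ κ))))
        ≡⟨ cong₂ _+_ (X-∑ n b₁ m α d) (qX-∑ n b₁ m α d) ⟨
      Xcoef n b₁ m α d + qpow 1 (Xcoef n b₁ m α) d
        ≡⟨ qint-2 (Xcoef n b₁ m α) d ⟨
      qint 2 (Xcoef n b₁ m α) d
        ∎
      where open ≡-Reasoning

reach-step : ∀ {n a} → IsAreaSeq n a → ∀ j → 1 ≤ j → j < n → j + a j ≤ suc j + a (suc j)
reach-step {a = a} (_ , _ , descent) j 1≤j j<n = begin
  j + a j              ≤⟨ +-monoʳ-≤ j (≤-trans (m≤n+m∸n (a j) 1) (s≤s (descent j 1≤j j<n))) ⟩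
  j + suc (a (suc j))  ≡⟨ +-suc j (a (suc j)) ⟩
  suc j + a (suc j)    ∎
  where open ≤-Reasoning

reach-mono : ∀ {n a} → IsAreaSeq n a → ∀ {x y} → 1 ≤ x → x ≤ y → y ≤ n → x + a x ≤ y + a y
reach-mono {n} {a} area {x} {y} 1≤x x≤y y≤n =
  subst (λ t → x + a x ≤ t + a t) (m+[n∸m]≡n x≤y) (reachFrom (y ∸ x) (≤-trans (≤-reflexive (m+[n∸m]≡n x≤y)) y≤n))
  where
  reachFrom : ∀ k → x + k ≤ n → x + a x ≤ (x + k) + a (x + k)
  reachFrom zero    _       = ≤-reflexive (cong (λ t → t + a t) (sym (+-identityʳ x)))
  reachFrom (suc k) x+k+1≤n = begin
    x + a x                        ≤⟨ reachFrom k (≤-trans (n≤1+n (x + k)) x+k<n) ⟩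
    (x + k) + a (x + k)            ≤⟨ reach-step area (x + k) (≤-trans 1≤x (m≤m+n x k)) x+k<n ⟩
    suc (x + k) + a (suc (x + k))  ≡⟨ cong (λ t → t + a t) (sym (+-suc x k)) ⟩
    (x + suc k) + a (x + suc k)    ∎
    where
    open ≤-Reasoning
    x+k<n : x + k < n
    x+k<n = ≤-trans (≤-reflexive (sym (+-suc x k))) x+k+1≤n

ext0-pos : ∀ a j → 1 ≤ j → ext0 a j ≡ a j
ext0-pos a (suc j) _ = refl

-- The hypotheses of the theorem, with i = i₀ + 1 and A = a_i.  For every s with
-- s + 2 ≤ ℓ, the graphs of a^s ⊇ a^{s+1} ⊇ a^{s+2} satisfy the modular law with
-- u = i₀ + (A - s - 1) and v = u + 1 (vertices numbered from 0).
module Setup (n : ℕ) (a : ℕ → ℕ) (area : IsAreaSeq n a) (ℓ i₀ : ℕ) (i≤n : suc i₀ ≤ n)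
  (gap : ext0 a i₀ + (ℓ ∸ 1) ≤ a (suc i₀)) (ℓ≤A : ℓ ≤ a (suc i₀))
  (chain : ∀ t → 1 ≤ t → t ≤ ℓ ∸ 1 →
           a (suc i₀ + a (suc i₀) ∸ t) ≡ a (suc (suc i₀ + a (suc i₀) ∸ t)) + 1) where

  private
    A : ℕ
    A = a (suc i₀)

    i+A≤n : suc i₀ + A ≤ n
    i+A≤n = ≤-trans (+-monoʳ-≤ (suc i₀) (proj₁ (proj₂ area) (suc i₀) (s≤s z≤n) i≤n))
                    (≤-reflexive (m+[n∸m]≡n i≤n))

  module Step (s : ℕ) (2+s≤ℓ : 2 + s ≤ ℓ) where

    private
      w : ℕ
      w = A ∸ (2 + s)

      2+s≤A : 2 + s ≤ A
      2+s≤A = ≤-trans 2+s≤ℓ ℓ≤A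

      1+s≤ℓ-1 : suc s ≤ ℓ ∸ 1
      1+s≤ℓ-1 = ∸-monoˡ-≤ 1 2+s≤ℓ

      A∸[1+s] : A ∸ suc s ≡ suc w
      A∸[1+s] = +-∸-assoc 1 2+s≤A

      A∸s : A ∸ s ≡ suc (suc w)
      A∸s = trans (+-∸-assoc 1 (<⇒≤ 2+s≤A)) (cong suc A∸[1+s])

      U V : ℕ
      U = i₀ + suc w
      V = suc U

      i₀<U : i₀ < U
      i₀<U = ≤-trans (s≤s (m≤m+n i₀ w)) (≤-reflexive (sym (+-suc i₀ w)))

      V≡ : V ≡ i₀ + (A ∸ s)
      V≡ = trans (sym (+-suc i₀ (suc w))) (cong (i₀ +_) (sym A∸s))

      V<n : V < n
      V<n = ≤-trans (s≤s (≤-trans (≤-reflexive V≡) (+-monoʳ-≤ i₀ (m∸n≤m A s)))) i+A≤n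

      U<n : U < n
      U<n = <-trans (n<1+n U) V<n

      b₂ : ℕ → ℕ
      b₂ = modify a (suc i₀) (2 + s)

      b₂-away : ∀ t → t ≢ i₀ → b₂ (suc t) ≡ a (suc t)
      b₂-away t t≢i₀ = modify-away a (suc i₀) (2 + s) (suc t) (λ e → t≢i₀ (suc-injective e))

      -- The hypothesis a_{i+a_i-t} = a_{i+a_i-t+1} + 1 for t = s + 1.
      chain-u : a (suc U) ≡ a (suc V) + 1
      chain-u = subst (λ x → a x ≡ a (suc x) + 1) index (chain (suc s) (s≤s z≤n) 1+s≤ℓ-1)
        where
        index : suc i₀ + A ∸ suc s ≡ suc U
        index = trans (+-∸-assoc (suc i₀) (<⇒≤ 2+s≤A)) (cong (λ x → suc (i₀ + x)) A∸[1+s])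

      sameEnd : U + b₂ (suc U) ≡ V + b₂ (suc V)
      sameEnd = begin
        U + b₂ (suc U)          ≡⟨ cong (U +_) (trans (b₂-away U (>⇒≢ i₀<U)) chain-u) ⟩
        U + (a (suc V) + 1)     ≡⟨ cong (U +_) (+-comm (a (suc V)) 1) ⟩
        U + suc (a (suc V))     ≡⟨ +-suc U (a (suc V)) ⟩
        V + a (suc V)           ≡⟨ cong (V +_) (b₂-away V (>⇒≢ (<-trans i₀<U (n<1+n U)))) ⟨
        V + b₂ (suc V)          ∎
        where open ≡-Reasoning

      adjacent : V ≤ U + b₂ (suc U)
      adjacent = ≤-trans (m≤m+n V (b₂ (suc V))) (≤-reflexive (sym sameEnd))

      -- Every vertex t < u sees both u and v or neither: vertex i₀ stops just before u,
      -- vertices before i₀ stop before u by the gap hypothesis, vertices after i₀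
      -- reach at least as far as i₀ did originally, which is beyond v.
      earlier : ∀ t → t < U → t + b₂ (suc t) < U ⊎ V ≤ t + b₂ (suc t)
      earlier t t<U with <-cmp t i₀
      ... | tri≈ _ refl _ = inj₁ (begin
        suc (t + b₂ (suc t))     ≡⟨ cong (λ x → suc (t + x)) (modify-at a (suc t) (2 + s)) ⟩
        suc (t + w)              ≡⟨ +-suc t w ⟨
        U                        ∎)
        where open ≤-Reasoning
      ... | tri> _ _ i₀<t = inj₂ (begin
        V                        ≤⟨ ≤-trans (≤-reflexive V≡) (+-monoʳ-≤ i₀ (m∸n≤m A s)) ⟩
        i₀ + A                   ≤⟨ s≤s⁻¹ (reach-mono area (s≤s z≤n) (s≤s (<⇒≤ i₀<t)) (<-trans t<U U<n)) ⟩
        t + a (suc t)            ≡⟨ cong (t +_) (b₂-away t (>⇒≢ i₀<t)) ⟨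
        t + b₂ (suc t)           ∎)
        where open ≤-Reasoning
      ... | tri< t<i₀ _ _ = inj₁ (begin
        suc t + b₂ (suc t)       ≡⟨ cong (suc t +_) (b₂-away t (<⇒≢ t<i₀)) ⟩
        suc t + a (suc t)        ≤⟨ reach-mono area (s≤s z≤n) t<i₀ (<⇒≤ i≤n) ⟩
        i₀ + a i₀                ≤⟨ +-monoʳ-≤ i₀ (m+n≤o⇒m≤o∸n (a i₀) aᵢ₋₁+s+1≤A) ⟩
        i₀ + (A ∸ suc s)         ≡⟨ cong (i₀ +_) A∸[1+s] ⟩
        U                        ∎)
        where
        open ≤-Reasoning
        aᵢ₋₁+s+1≤A : a i₀ + suc s ≤ A
        aᵢ₋₁+s+1≤A = ≤-trans (+-monoʳ-≤ (a i₀) 1+s≤ℓ-1)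
                             (subst (λ x → x + (ℓ ∸ 1) ≤ A) (ext0-pos a i₀ (≤-trans (s≤s z≤n) t<i₀)) gap)

    private
      I u v : Fin n
      I = fromℕ< i≤n
      u = fromℕ< U<n
      v = fromℕ< V<n

      toℕ-I : toℕ I ≡ i₀
      toℕ-I = FinP.toℕ-fromℕ< i≤n

      toℕ-u : toℕ u ≡ U
      toℕ-u = FinP.toℕ-fromℕ< U<n

      toℕ-v : toℕ v ≡ V
      toℕ-v = FinP.toℕ-fromℕ< V<n

      v≡u+1 : toℕ v ≡ suc (toℕ u)
      v≡u+1 = trans toℕ-v (cong suc (sym toℕ-u))

      earlier' : ∀ t → t < toℕ u → t + b₂ (suc t) < toℕ u ⊎ toℕ v ≤ t + b₂ (suc t)
      earlier' rewrite toℕ-u | toℕ-v = earlier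

      sameEnd' : toℕ u + b₂ (suc (toℕ u)) ≡ toℕ v + b₂ (suc (toℕ v))
      sameEnd' rewrite toℕ-u | toℕ-v = sameEnd

      adjacent' : toℕ v ≤ toℕ u + b₂ (suc (toℕ u))
      adjacent' rewrite toℕ-u | toℕ-v = adjacent

      I≢u : I ≢ u
      I≢u I≡u = <⇒≢ i₀<U (trans (sym toℕ-I) (trans (cong toℕ I≡u) toℕ-u))

      I≢v : I ≢ v
      I≢v I≡v = <⇒≢ (<-trans i₀<U (n<1+n U)) (trans (sym toℕ-I) (trans (cong toℕ I≡v) toℕ-v))

      extra-v : ∀ p → edge (modify a (suc i₀) s) p ≡ 𝟙 (p ≟² (I , v)) + edge (modify a (suc i₀) (suc s)) p
      extra-v = RemoveEdge.edge-removed a i₀ s (≤-trans (n≤1+n (suc s)) 2+s≤A) I v toℕ-I (trans toℕ-v V≡)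

      extra-u : ∀ p → edge (modify a (suc i₀) (suc s)) p ≡ 𝟙 (p ≟² (I , u)) + edge b₂ p
      extra-u = RemoveEdge.edge-removed a i₀ (suc s) 2+s≤A I u toℕ-I (trans toℕ-u (cong (i₀ +_) (sym A∸[1+s])))

    open ModularLaw (modify a (suc i₀) s) (modify a (suc i₀) (suc s)) b₂ I u v v≡u+1
                    earlier' sameEnd' adjacent' I≢u I≢v extra-v extra-u public

theorem3p4 :
    (n : ℕ) → 3 ≤ n → (a : ℕ → ℕ) → IsAreaSeq n a →
    (ℓ : ℕ) → 2 ≤ ℓ → ℓ ≤ n ∸ 1 →
    (i : ℕ) → 1 ≤ i → i ≤ n →
    ext0 a (i ∸ 1) + (ℓ ∸ 1) ≤ a i →
    ℓ ≤ a i →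
    ((z : ℕ) → z ≤ ℓ → IsAreaSeq n (modify a i z)) →
    ((t : ℕ) → 1 ≤ t → t ≤ ℓ ∸ 1 → a (i + a i ∸ t) ≡ a (suc (i + a i ∸ t)) + 1) →
    (k : ℕ) → 1 ≤ k → k ≤ ℓ ∸ 1 →
    ((m : ℕ) → (α : Vec ℕ m) →
      ((LLTcoef n (modify a i 0) m α ⊕ qpow 1 (qint k (LLTcoef n (modify a i (suc k)) m α)))
        ≐ qint (suc k) (LLTcoef n (modify a i k) m α))
      ×
      ((qint (ℓ ∸ k) (LLTcoef n (modify a i 0) m α)
          ⊕ qpow (ℓ ∸ k) (qint k (LLTcoef n (modify a i ℓ) m α)))
        ≐ qint ℓ (LLTcoef n (modify a i k) m α))
      ×
      ((Xcoef n (modify a i 0) m α ⊕ qpow 1 (qint k (Xcoef n (modify a i (suc k)) m α)))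
        ≐ qint (suc k) (Xcoef n (modify a i k) m α))
      ×
      ((qint (ℓ ∸ k) (Xcoef n (modify a i 0) m α)
          ⊕ qpow (ℓ ∸ k) (qint k (Xcoef n (modify a i ℓ) m α)))
        ≐ qint ℓ (Xcoef n (modify a i k) m α)))
theorem3p4 n _ a area ℓ 2≤ℓ _ (suc i₀) _ i≤n gap ℓ≤aᵢ _ chain k _ k≤ℓ-1 m α =
  relationA modularLLT k k<ℓ , relationB modularLLT k (ℓ ∸ k) k+[ℓ-k]≡ℓ ,
  relationA modularX k k<ℓ , relationB modularX k (ℓ ∸ k) k+[ℓ-k]≡ℓ
  where
  open Setup n a area ℓ i₀ i≤n gap ℓ≤aᵢ chain

  modularLLT : ModularUpTo (λ z → LLTcoef n (modify a (suc i₀) z) m α) ℓ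
  modularLLT s 2+s≤ℓ = Step.modular-LLT s 2+s≤ℓ m α

  modularX : ModularUpTo (λ z → Xcoef n (modify a (suc i₀) z) m α) ℓ
  modularX s 2+s≤ℓ = Step.modular-X s 2+s≤ℓ m α

  k<ℓ : k < ℓ
  k<ℓ = ≤-trans (s≤s k≤ℓ-1) (≤-reflexive (m+[n∸m]≡n (≤-trans (s≤s z≤n) 2≤ℓ)))

  k+[ℓ-k]≡ℓ : k + (ℓ ∸ k) ≡ ℓ
  k+[ℓ-k]≡ℓ = m+[n∸m]≡n (<⇒≤ k<ℓ)
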